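{- There are instances $(X, k)$ of the $k$-means problem which are $\gamma$-distributed, but are not $(1 + \Omega(\gamma))$-weakly deletion stable, for some parameter $\gamma > 0$.
   Context: $OPT^{\star}$ denotes the optimal $k$-means cost of $X$, i.e. the minimum over $k$-center sets $C$ of $\sum_{x\in X}\min_{c\in C}\|x-c\|^2$, and $\mu(Y)$ the centroid of $Y$. An instance $(X,k)$ is $\gamma$-distributed iff for every optimal clustering $\{X_1^{\star},\ldots,X_k^{\star}\}$, for all $i$ and all $x \notin X_i^{\star}$, $\|x - \mu(X_i^{\star})\|^2 \geq \gamma\cdot\frac{OPT^{\star}}{|X_i^{\star}|}$. Let $c_1^{\star},\ldots,c_k^{\star}$ be an optimal set of $k$ centers (each point assigned to its closest center). The instance is $(1+\gamma)$-weakly deletion stable if for all $i \neq j$, $OPT^{(i\to j)} > (1+\gamma)\,OPT^{\star}$, where $OPT^{(i\to j)}$ is the cost of the clustering obtained by removing $c_i^{\star}$ as a center and assigning all points assigned to it to $c_j^{\star}$. -}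

module Defs where

open import Data.Nat as ℕ using (ℕ; zero; suc)
open import Data.Fin using (Fin; zero; suc; _≟_)
open import Data.Vec as V using (Vec)
open import Data.Rational using (ℚ; 0ℚ; 1ℚ; _+_; _*_; _-_; _≤_; _<_; _⊓_; _/_)
open import Data.Integer using (+_)
open import Data.Product using (Σ-syntax; _×_)
open import Relation.Nullary using (¬_; yes; no)
open import Relation.Binary.PropositionalEquality using (_≡_)

Point : ℕ → Set
Point d = Vec ℚ d

sqDist : ∀ {d} → Point d → Point d → ℚ
sqDist x y = V.foldr _ _+_ 0ℚ (V.zipWith (λ a b → (a - b) * (a - b)) x y)

vadd : ∀ {d} → Point d → Point d → Point d
vadd = V.zipWith _+_

vscale : ∀ {d} → ℚ → Point d → Point d
vscale r = V.map (r *_)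

sumF : ∀ {n} → (Fin n → ℚ) → ℚ
sumF {zero} f = 0ℚ
sumF {suc n} f = f zero + sumF (λ i → f (suc i))

-- minimum over Fin k (value 0 for k = 0; only used with k ≥ 1)
minF : ∀ {k} → (Fin k → ℚ) → ℚ
minF {zero} f = 0ℚ
minF {suc zero} f = f zero
minF {suc (suc k)} f = f zero ⊓ minF (λ i → f (suc i))

-- 1/m for m ≥ 1 (value 0 at m = 0; only used for nonempty clusters)
safeInv : ℕ → ℚ
safeInv zero = 0ℚ
safeInv (suc m) = + 1 / suc m

module _ {d n k : ℕ} (X : Fin n → Point d) where

  cost : (Fin k → Point d) → ℚ
  cost C = sumF (λ x → minF (λ i → sqDist (X x) (C i)))

  IsOptimalCenters : (Fin k → Point d) → Set
  IsOptimalCenters C = ∀ (C' : Fin k → Point d) → cost C ≤ cost C'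

  ClosestAssignment : (Fin k → Point d) → (Fin n → Fin k) → Set
  ClosestAssignment C a = ∀ (x : Fin n) (l : Fin k) → sqDist (X x) (C (a x)) ≤ sqDist (X x) (C l)

  -- a clustering {X_1..X_k} is given by a labelling a : Fin n → Fin k
  -- |X_i|
  size : (Fin n → Fin k) → Fin k → ℕ
  size a i = go a
    where
    go : ∀ {m} → (Fin m → Fin k) → ℕ
    go {zero} b = zero
    go {suc m} b with b zero ≟ i
    ... | yes _ = suc (go (λ y → b (suc y)))
    ... | no _ = go (λ y → b (suc y))

  clusterSum : (Fin n → Fin k) → Fin k → Point d
  clusterSum a i = go X a
    where
    go : ∀ {m} → (Fin m → Point d) → (Fin m → Fin k) → Point d
    go {zero} Y b = V.replicate d 0ℚ
    go {suc m} Y b with b zero ≟ i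
    ... | yes _ = vadd (Y zero) (go (λ y → Y (suc y)) (λ y → b (suc y)))
    ... | no _ = go (λ y → Y (suc y)) (λ y → b (suc y))

  centroid : (Fin n → Fin k) → Fin k → Point d
  centroid a i = vscale (safeInv (size a i)) (clusterSum a i)

  clusterCost : (Fin n → Fin k) → ℚ
  clusterCost a = sumF (λ x → sqDist (X x) (centroid a (a x)))

  IsOptimalClustering : (Fin n → Fin k) → Set
  IsOptimalClustering a =
    (∀ (i : Fin k) → 0 ℕ.< size a i) × (∀ (C' : Fin k → Point d) → clusterCost a ≤ cost C')

  -- γ-distributed (OPT* = clusterCost a for the optimal clustering a)
  GammaDistributed : ℚ → Set
  GammaDistributed γ =
    ∀ (a : Fin n → Fin k) → IsOptimalClustering a →
    ∀ (i : Fin k) (x : Fin n) → ¬ (a x ≡ i) →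
    γ * clusterCost a * safeInv (size a i) ≤ sqDist (X x) (centroid a i)

  deletionCost : (Fin k → Point d) → (Fin n → Fin k) → Fin k → Fin k → ℚ
  deletionCost C a i j = sumF (λ x → sqDist (X x) (C (redirect (a x))))
    where
    redirect : Fin k → Fin k
    redirect l with l ≟ i
    ... | yes _ = j
    ... | no _ = l

  WeaklyDeletionStable : ℚ → Set
  WeaklyDeletionStable β =
    ∀ (C : Fin k → Point d) → IsOptimalCenters C →
    ∀ (a : Fin n → Fin k) → ClosestAssignment C a →
    ∀ (i j : Fin k) → ¬ (i ≡ j) → β * cost C < deletionCost C a i j

  HasKDistinctPoints : Set
  HasKDistinctPoints =
    Σ[ f ∈ (Fin k → Fin n) ] (∀ (i j : Fin k) → X (f i) ≡ X (f j) → i ≡ j)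

module Submission where

-- Take k = 2 and, in ℚ^(1+s), the points q l = (h, e l) for l < s together with w copies of
-- the origin O. About any centre, a cluster holding a of the q's and b copies of O costs at
-- least a - a/(a+b) + a b h²/(a+b), so every assignment to two centres costs at least
-- (s - 1) + E with E = 1 + Σᵢ αᵢ (βᵢ - 1), αᵢ = aᵢ/(aᵢ+bᵢ) ∈ [0,1] and βᵢ = bᵢ h².
-- When w h² > 2 we get E ≥ 0, with equality only for the split {q's} | {O's}, which the
-- centres O and (h, 1/s, …, 1/s) attain. Hence OPT = s - 1, the split is the only optimal
-- clustering, and its centroids are pinned: each q is at squared distance ≥ 1/2 from the
-- centroid of the O's, and O at ≥ h²/2 from that of the q's. So the instance is
-- γ-distributed with γ·OPT = G whenever 2G ≤ w and 2G ≤ s h². Deleting the centre O costs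
-- only w (h² + 1/s) more; for h = 1/n, w = 3n², s = 3n⁴ and G = n² this is 3 + 1/n², at
-- most c·G once n ≥ 2/c.

module KMeansCounterexample where
  open import Defs
  open import Data.Nat as ℕ using (ℕ; zero; suc)
  import Data.Nat.Properties as ℕ
  open import Data.Fin as Fin using (Fin; zero; suc; _↑ˡ_; _↑ʳ_)
  open import Data.Fin.Properties using (splitAt-↑ˡ; splitAt-↑ʳ; splitAt⁻¹-↑ˡ; splitAt⁻¹-↑ʳ)
  open import Data.Rational as ℚ using (ℚ; 0ℚ; 1ℚ; _+_; _*_; _-_; _≤_; _<_; 1/_; mkℚ; toℚᵘ)
  open import Data.Rational.Properties
  open import Data.Rational.Solver
  import Data.Rational.Unnormalised as ℚᵘ
  import Data.Rational.Unnormalised.Properties as ℚᵘ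
  import Data.Integer as ℤ
  import Data.Integer.Properties as ℤ
  open import Data.Nat.Coprimality using (1-coprimeTo)
  open import Data.Sum using (_⊎_; inj₁; inj₂)
  open import Data.Product using (_×_; _,_; Σ; proj₁; proj₂)
  open import Data.Empty using (⊥-elim)
  open import Data.Vec as Vec using (Vec; []; _∷_; lookup; tabulate; replicate)
  open import Data.Vec.Properties using (lookup∘tabulate; lookup-replicate; ∷-injectiveˡ)
  open import Relation.Nullary using (yes; no; ¬_; Dec)
  open import Relation.Binary.PropositionalEquality
  open import Relation.Binary.Definitions using (tri<; tri≈; tri>)
  open +-*-Solver

  sq : ℚ → ℚ
  sq x = x * x

  two : ℚ
  two = 1ℚ + 1ℚ

  0≤1 : 0ℚ ≤ 1ℚ
  0≤1 = nonNegative⁻¹ 1ℚ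

  0≤sq : ∀ x → 0ℚ ≤ sq x
  0≤sq x with ≤-total 0ℚ x
  ... | inj₁ p = nonNegative⁻¹ (x * x) {{nonNeg*nonNeg⇒nonNeg x {{ℚ.nonNegative p}} x {{ℚ.nonNegative p}}}}
  ... | inj₂ p = nonNegative⁻¹ (x * x) {{nonPos*nonPos⇒nonPos x {{ℚ.nonPositive p}} x {{ℚ.nonPositive p}}}}

  ≤-byGap : ∀ {p q} e → 0ℚ ≤ e → q ≡ p + e → p ≤ q
  ≤-byGap {p} {q} e 0≤e q≡p+e = begin
      p        ≡⟨ sym (+-identityʳ p) ⟩
      p + 0ℚ   ≤⟨ +-monoʳ-≤ p 0≤e ⟩
      p + e    ≡⟨ sym q≡p+e ⟩
      q        ∎
    where open ≤-Reasoning

  p≤q⇒0≤q-p : ∀ {p q} → p ≤ q → 0ℚ ≤ q - p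
  p≤q⇒0≤q-p {p} {q} p≤q = begin
      0ℚ      ≡⟨ sym (+-inverseʳ p) ⟩
      p - p   ≤⟨ +-monoˡ-≤ (ℚ.- p) p≤q ⟩
      q - p   ∎
    where open ≤-Reasoning

  +-nonNeg : ∀ {p q} → 0ℚ ≤ p → 0ℚ ≤ q → 0ℚ ≤ p + q
  +-nonNeg 0≤p 0≤q = ≤-trans 0≤p (≤-byGap _ 0≤q refl)

  *-nonNeg : ∀ {p q} → 0ℚ ≤ p → 0ℚ ≤ q → 0ℚ ≤ p * q
  *-nonNeg {p} {q} 0≤p 0≤q = nonNegative⁻¹ (p * q) {{nonNeg*nonNeg⇒nonNeg p {{ℚ.nonNegative 0≤p}} q {{ℚ.nonNegative 0≤q}}}}

  *-pos : ∀ {p q} → 0ℚ < p → 0ℚ < q → 0ℚ < p * q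
  *-pos {p} {q} 0<p 0<q = positive⁻¹ (p * q) {{pos*pos⇒pos p {{ℚ.positive 0<p}} q {{ℚ.positive 0<q}}}}

  <⇒≱ : ∀ {p q} → p < q → ¬ (q ≤ p)
  <⇒≱ p<q q≤p = <-irrefl refl (<-≤-trans p<q q≤p)

  pos⇒≢0 : ∀ {p} → 0ℚ < p → ¬ (p ≡ 0ℚ)
  pos⇒≢0 0<p p≡0 = <-irrefl (sym p≡0) 0<p

  pos*q≤0⇒q≤0 : ∀ {p q} → 0ℚ < p → p * q ≤ 0ℚ → q ≤ 0ℚ
  pos*q≤0⇒q≤0 0<p pq≤0 = ≮⇒≥ (λ 0<q → <⇒≱ (*-pos 0<p 0<q) pq≤0)

  nonNeg+nonNeg≤0 : ∀ {p q} → 0ℚ ≤ p → 0ℚ ≤ q → p + q ≤ 0ℚ → (p ≤ 0ℚ) × (q ≤ 0ℚ)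
  nonNeg+nonNeg≤0 {p} {q} 0≤p 0≤q p+q≤0 =
    ≤-trans (≤-byGap q 0≤q refl) p+q≤0 , ≤-trans (≤-byGap p 0≤p (+-comm p q)) p+q≤0

  +-cancelˡ-≤ : ∀ m {p q} → m + p ≤ m + q → p ≤ q
  +-cancelˡ-≤ m {p} {q} le = begin
      p               ≡⟨ solve 2 (λ m p → p := (m :+ p) :- m) refl m p ⟩
      (m + p) - m     ≤⟨ +-monoˡ-≤ (ℚ.- m) le ⟩
      (m + q) - m     ≡⟨ solve 2 (λ m q → (m :+ q) :- m := q) refl m q ⟩
      q               ∎
    where open ≤-Reasoning

  -- Total: recip 0ℚ = 0ℚ.
  recip : ℚ → ℚ
  recip p with p ℚ.≟ 0ℚ
  ... | yes _ = 0ℚ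
  ... | no p≢0 = (1/ p) {{ℚ.≢-nonZero p≢0}}

  *-recip : ∀ p → ¬ (p ≡ 0ℚ) → p * recip p ≡ 1ℚ
  *-recip p p≢0 with p ℚ.≟ 0ℚ
  ... | yes p≡0 = ⊥-elim (p≢0 p≡0)
  ... | no p≢0′ = *-inverseʳ p {{ℚ.≢-nonZero p≢0′}}

  recip-0 : ∀ p → p ≡ 0ℚ → recip p ≡ 0ℚ
  recip-0 p p≡0 with p ℚ.≟ 0ℚ
  ... | yes _ = refl
  ... | no p≢0 = ⊥-elim (p≢0 p≡0)

  recip-nonNeg : ∀ p → 0ℚ ≤ p → 0ℚ ≤ recip p
  recip-nonNeg p 0≤p with p ℚ.≟ 0ℚ
  ... | yes _ = ≤-refl
  ... | no p≢0 = <⇒≤ (positive⁻¹ _ {{1/pos⇒pos p {{nonNeg∧nonZero⇒pos p {{ℚ.nonNegative 0≤p}} {{ℚ.≢-nonZero p≢0}}}}}})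

  recip-pos : ∀ p → 0ℚ < p → 0ℚ < recip p
  recip-pos p 0<p with p ℚ.≟ 0ℚ
  ... | yes p≡0 = ⊥-elim (pos⇒≢0 0<p p≡0)
  ... | no _ = positive⁻¹ _ {{1/pos⇒pos p {{ℚ.positive 0<p}}}}

  fromℕ : ℕ → ℚ
  fromℕ zero = 0ℚ
  fromℕ (suc n) = 1ℚ + fromℕ n

  fromℕ-nonNeg : ∀ n → 0ℚ ≤ fromℕ n
  fromℕ-nonNeg zero = ≤-refl
  fromℕ-nonNeg (suc n) = +-nonNeg 0≤1 (fromℕ-nonNeg n)

  1≤fromℕ-suc : ∀ n → 1ℚ ≤ fromℕ (suc n)
  1≤fromℕ-suc n = ≤-byGap (fromℕ n) (fromℕ-nonNeg n) refl

  fromℕ-suc-pos : ∀ n → 0ℚ < fromℕ (suc n)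
  fromℕ-suc-pos n = <-≤-trans (positive⁻¹ 1ℚ) (1≤fromℕ-suc n)

  1<fromℕ-2+ : ∀ n → 1ℚ < fromℕ (suc (suc n))
  1<fromℕ-2+ n = begin-strict
      1ℚ                         ≡⟨ sym (+-identityʳ 1ℚ) ⟩
      1ℚ + 0ℚ                    <⟨ +-monoʳ-< 1ℚ (fromℕ-suc-pos n) ⟩
      1ℚ + fromℕ (suc n)         ∎
    where open ≤-Reasoning

  fromℕ-+ : ∀ m n → fromℕ (m ℕ.+ n) ≡ fromℕ m + fromℕ n
  fromℕ-+ zero n = sym (+-identityˡ (fromℕ n))
  fromℕ-+ (suc m) n = trans (cong (1ℚ +_) (fromℕ-+ m n)) (sym (+-assoc 1ℚ (fromℕ m) (fromℕ n)))

  fromℕ-* : ∀ m n → fromℕ (m ℕ.* n) ≡ fromℕ m * fromℕ n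
  fromℕ-* zero n = sym (*-zeroˡ (fromℕ n))
  fromℕ-* (suc m) n = trans (fromℕ-+ n (m ℕ.* n)) (trans (cong (fromℕ n +_) (fromℕ-* m n))
    (solve 2 (λ a b → b :+ a :* b := (con 1ℚ :+ a) :* b) refl (fromℕ m) (fromℕ n)))

  fromℕ-injective : ∀ m n → fromℕ m ≡ fromℕ n → m ≡ n
  fromℕ-injective zero zero _ = refl
  fromℕ-injective zero (suc n) eq = ⊥-elim (pos⇒≢0 (fromℕ-suc-pos n) (sym eq))
  fromℕ-injective (suc m) zero eq = ⊥-elim (pos⇒≢0 (fromℕ-suc-pos m) eq)
  fromℕ-injective (suc m) (suc n) eq = cong suc (fromℕ-injective m n (begin
      fromℕ m                 ≡⟨ solve 1 (λ x → x := (con 1ℚ :+ x) :- con 1ℚ) refl (fromℕ m) ⟩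
      (1ℚ + fromℕ m) - 1ℚ     ≡⟨ cong (_- 1ℚ) eq ⟩
      (1ℚ + fromℕ n) - 1ℚ     ≡⟨ solve 1 (λ x → (con 1ℚ :+ x) :- con 1ℚ := x) refl (fromℕ n) ⟩
      fromℕ n                 ∎))
    where open ≡-Reasoning

  toℚᵘ-fromℕ : ∀ n → toℚᵘ (fromℕ n) ℚᵘ.≃ ℚᵘ.mkℚᵘ (ℤ.+ n) 0
  toℚᵘ-fromℕ zero = ℚᵘ.≃-refl
  toℚᵘ-fromℕ (suc n) = ℚᵘ.≃-trans (toℚᵘ-homo-+ 1ℚ (fromℕ n)) (ℚᵘ.≃-trans (ℚᵘ.+-congʳ ℚᵘ.1ℚᵘ (toℚᵘ-fromℕ n))
    (ℚᵘ.*≡* (cong (λ y → (ℤ.+ 1 ℤ.+ y) ℤ.* ℤ.+ 1) (ℤ.*-identityʳ (ℤ.+ n)))))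

  ≃1/suc⇒*fromℕ-suc≡1 : ∀ (m : ℕ) (r : ℚ) → toℚᵘ r ℚᵘ.≃ ℚᵘ.mkℚᵘ (ℤ.+ 1) m → r * fromℕ (suc m) ≡ 1ℚ
  ≃1/suc⇒*fromℕ-suc≡1 m r r≃ = toℚᵘ-injective (ℚᵘ.≃-trans (toℚᵘ-homo-* r (fromℕ (suc m)))
     (ℚᵘ.≃-trans (ℚᵘ.*-cong r≃ (toℚᵘ-fromℕ (suc m))) (ℚᵘ.*-inverseˡ (ℚᵘ.mkℚᵘ (ℤ.+ suc m) 0))))

  safeInv*fromℕ : ∀ m → safeInv (suc m) * fromℕ (suc m) ≡ 1ℚ
  safeInv*fromℕ m = ≃1/suc⇒*fromℕ-suc≡1 m (safeInv (suc m)) (toℚᵘ-fromℚᵘ (ℚᵘ.mkℚᵘ (ℤ.+ 1) m))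

  safeInv-nonNeg : ∀ m → 0ℚ ≤ safeInv m
  safeInv-nonNeg zero = ≤-refl
  safeInv-nonNeg (suc m) = nonNegative⁻¹ _ {{normalize-nonNeg 1 (suc m)}}

  archimedean : ∀ c → 0ℚ < c → Σ ℕ (λ m → 1ℚ ≤ c * fromℕ (suc m))
  archimedean c@(mkℚ ℤ.+[1+ p ] m _) 0<c = m , (begin
      1ℚ                    ≡⟨ sym (≃1/suc⇒*fromℕ-suc≡1 m r ℚᵘ.≃-refl) ⟩
      r * fromℕ (suc m)     ≤⟨ *-monoʳ-≤-nonNeg (fromℕ (suc m)) {{ℚ.nonNegative (fromℕ-nonNeg (suc m))}} r≤c ⟩
      c * fromℕ (suc m)     ∎)
    where
    open ≤-Reasoning
    r : ℚ
    r = mkℚ (ℤ.+ 1) m (1-coprimeTo (suc m))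
    r≤c : r ≤ c
    r≤c = ℚ.*≤* (ℤ.+≤+ (ℕ.s≤s (ℕ.+-monoʳ-≤ m (ℕ.z≤n {p ℕ.* suc m}))))
  archimedean (mkℚ ℤ.+0 _ _) 0<c with () ← ℚ.positive 0<c
  archimedean (mkℚ ℤ.-[1+ _ ] _ _) 0<c with () ← ℚ.positive 0<c

  sumF-cong : ∀ {n} {f g : Fin n → ℚ} → (∀ i → f i ≡ g i) → sumF f ≡ sumF g
  sumF-cong {zero} _ = refl
  sumF-cong {suc n} f≡g = cong₂ _+_ (f≡g zero) (sumF-cong (λ i → f≡g (suc i)))

  sumF-+ : ∀ {n} (f g : Fin n → ℚ) → sumF (λ i → f i + g i) ≡ sumF f + sumF g
  sumF-+ {zero} f g = refl
  sumF-+ {suc n} f g = begin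
      (f zero + g zero) + sumF (λ i → f (suc i) + g (suc i))
        ≡⟨ cong ((f zero + g zero) +_) (sumF-+ (λ i → f (suc i)) (λ i → g (suc i))) ⟩
      (f zero + g zero) + (sumF (λ i → f (suc i)) + sumF (λ i → g (suc i)))
        ≡⟨ solve 4 (λ a b c d → (a :+ b) :+ (c :+ d) := (a :+ c) :+ (b :+ d)) refl (f zero) (g zero) _ _ ⟩
      (f zero + sumF (λ i → f (suc i))) + (g zero + sumF (λ i → g (suc i))) ∎
    where open ≡-Reasoning

  sumF-*ˡ : ∀ {n} a (f : Fin n → ℚ) → sumF (λ i → a * f i) ≡ a * sumF f
  sumF-*ˡ {zero} a f = sym (*-zeroʳ a)
  sumF-*ˡ {suc n} a f = trans (cong (a * f zero +_) (sumF-*ˡ a (λ i → f (suc i)))) (sym (*-distribˡ-+ a _ _))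

  sumF-const : ∀ {n} a → sumF {n} (λ _ → a) ≡ fromℕ n * a
  sumF-const {zero} a = sym (*-zeroˡ a)
  sumF-const {suc n} a = trans (cong (a +_) (sumF-const {n} a))
    (solve 2 (λ a b → a :+ b :* a := (con 1ℚ :+ b) :* a) refl a (fromℕ n))

  sumF-0 : ∀ {n} → sumF {n} (λ _ → 0ℚ) ≡ 0ℚ
  sumF-0 {n} = trans (sumF-const {n} 0ℚ) (*-zeroʳ (fromℕ n))

  sumF-mono : ∀ {n} {f g : Fin n → ℚ} → (∀ i → f i ≤ g i) → sumF f ≤ sumF g
  sumF-mono {zero} _ = ≤-refl
  sumF-mono {suc n} f≤g = +-mono-≤ (f≤g zero) (sumF-mono (λ i → f≤g (suc i)))

  sumF-nonNeg : ∀ {n} {f : Fin n → ℚ} → (∀ i → 0ℚ ≤ f i) → 0ℚ ≤ sumF f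
  sumF-nonNeg {n} 0≤f = ≤-trans (≤-reflexive (sym (sumF-0 {n}))) (sumF-mono 0≤f)

  term≤sumF : ∀ {n} {f : Fin n → ℚ} → (∀ i → 0ℚ ≤ f i) → ∀ k → f k ≤ sumF f
  term≤sumF {suc n} 0≤f zero = ≤-byGap _ (sumF-nonNeg (λ i → 0≤f (suc i))) refl
  term≤sumF {suc n} {f} 0≤f (suc k) =
    ≤-trans (term≤sumF (λ i → 0≤f (suc i)) k) (≤-byGap _ (0≤f zero) (+-comm (f zero) _))

  sumF-swap : ∀ {m n} (f : Fin m → Fin n → ℚ) →
    sumF (λ i → sumF (λ j → f i j)) ≡ sumF (λ j → sumF (λ i → f i j))
  sumF-swap {zero} {n} f = sym (sumF-0 {n})
  sumF-swap {suc m} f = trans (cong (sumF (f zero) +_) (sumF-swap (λ i → f (suc i))))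
    (sym (sumF-+ (f zero) _))

  sumF-++ : ∀ m {n} (f : Fin (m ℕ.+ n) → ℚ) →
    sumF f ≡ sumF (λ i → f (i ↑ˡ n)) + sumF (λ j → f (m ↑ʳ j))
  sumF-++ zero f = sym (+-identityˡ _)
  sumF-++ (suc m) f = trans (cong (f zero +_) (sumF-++ m (λ i → f (suc i)))) (sym (+-assoc (f zero) _ _))

  sumF-Fin2 : ∀ (f : Fin 2 → ℚ) → sumF f ≡ f zero + f (suc zero)
  sumF-Fin2 f = cong (f zero +_) (+-identityʳ (f (suc zero)))

  δ : ∀ {n} → Fin n → Fin n → ℚ
  δ zero zero = 1ℚ
  δ zero (suc _) = 0ℚ
  δ (suc _) zero = 0ℚ
  δ (suc k) (suc l) = δ k l

  δ-0∨1 : ∀ {n} (k l : Fin n) → (δ k l ≡ 0ℚ) ⊎ (δ k l ≡ 1ℚ)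
  δ-0∨1 zero zero = inj₂ refl
  δ-0∨1 zero (suc l) = inj₁ refl
  δ-0∨1 (suc k) zero = inj₁ refl
  δ-0∨1 (suc k) (suc l) = δ-0∨1 k l

  δ-nonNeg : ∀ {n} (k l : Fin n) → 0ℚ ≤ δ k l
  δ-nonNeg k l with δ-0∨1 k l
  ... | inj₁ δ≡0 = ≤-reflexive (sym δ≡0)
  ... | inj₂ δ≡1 = ≤-trans 0≤1 (≤-reflexive (sym δ≡1))

  δ-diag : ∀ {n} (k : Fin n) → δ k k ≡ 1ℚ
  δ-diag zero = refl
  δ-diag (suc k) = δ-diag k

  δ-≢ : ∀ {n} {k l : Fin n} → ¬ (k ≡ l) → δ k l ≡ 0ℚ
  δ-≢ {k = zero} {zero} k≢l = ⊥-elim (k≢l refl)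
  δ-≢ {k = zero} {suc l} _ = refl
  δ-≢ {k = suc k} {zero} _ = refl
  δ-≢ {k = suc k} {suc l} k≢l = δ-≢ (λ k≡l → k≢l (cong suc k≡l))

  δ-sym : ∀ {n} (k l : Fin n) → δ k l ≡ δ l k
  δ-sym zero zero = refl
  δ-sym zero (suc l) = refl
  δ-sym (suc k) zero = refl
  δ-sym (suc k) (suc l) = δ-sym k l

  sumF-δ : ∀ {n} (k : Fin n) (f : Fin n → ℚ) → sumF (λ l → δ k l * f l) ≡ f k
  sumF-δ {suc n} zero f = begin
      1ℚ * f zero + sumF (λ l → 0ℚ * f (suc l))
        ≡⟨ cong (1ℚ * f zero +_) (trans (sumF-cong (λ l → *-zeroˡ (f (suc l)))) (sumF-0 {n})) ⟩
      1ℚ * f zero + 0ℚ ≡⟨ solve 1 (λ a → con 1ℚ :* a :+ con 0ℚ := a) refl (f zero) ⟩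
      f zero ∎
    where open ≡-Reasoning
  sumF-δ (suc k) f = trans (cong (0ℚ * f zero +_) (sumF-δ k (λ l → f (suc l))))
    (solve 2 (λ a b → con 0ℚ :* a :+ b := b) refl (f zero) (f (suc k)))

  sq-δ- : ∀ {n} (k l : Fin n) a → sq (δ k l - a) ≡ sq a + δ k l * (1ℚ - two * a)
  sq-δ- k l a with δ-0∨1 k l
  ... | inj₁ δ≡0 rewrite δ≡0 = solve 1 (λ a → (con 0ℚ :- a) :* (con 0ℚ :- a)
          := a :* a :+ con 0ℚ :* (con 1ℚ :- (con 1ℚ :+ con 1ℚ) :* a)) refl a
  ... | inj₂ δ≡1 rewrite δ≡1 = solve 1 (λ a → (con 1ℚ :- a) :* (con 1ℚ :- a)
          := a :* a :+ con 1ℚ :* (con 1ℚ :- (con 1ℚ :+ con 1ℚ) :* a)) refl a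

  count : ∀ {m k} → (Fin m → Fin k) → Fin k → ℚ
  count P i = sumF (λ x → δ (P x) i)

  count-nonNeg : ∀ {m k} (P : Fin m → Fin k) i → 0ℚ ≤ count P i
  count-nonNeg P i = sumF-nonNeg (λ x → δ-nonNeg (P x) i)

  sumF-byLabel : ∀ {m k} (P : Fin m → Fin k) (g : Fin k → ℚ) →
    sumF (λ x → g (P x)) ≡ sumF (λ i → count P i * g i)
  sumF-byLabel P g = begin
      sumF (λ x → g (P x))
        ≡⟨ sumF-cong (λ x → sym (sumF-δ (P x) g)) ⟩
      sumF (λ x → sumF (λ i → δ (P x) i * g i))
        ≡⟨ sumF-swap (λ x i → δ (P x) i * g i) ⟩
      sumF (λ i → sumF (λ x → δ (P x) i * g i))
        ≡⟨ sumF-cong (λ i → trans (sumF-cong (λ x → *-comm (δ (P x) i) (g i))) (trans (sumF-*ˡ (g i) (λ x → δ (P x) i)) (*-comm (g i) _))) ⟩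
      sumF (λ i → count P i * g i) ∎
    where open ≡-Reasoning

  count-const : ∀ {m k} (P : Fin m → Fin k) c → (∀ x → P x ≡ c) → ∀ i → count P i ≡ fromℕ m * δ c i
  count-const {m} P c P≡c i = trans (sumF-cong (λ x → cong (λ b → δ b i) (P≡c x))) (sumF-const {m} (δ c i))

  count-sum : ∀ {m k} (P : Fin m → Fin k) → sumF (count P) ≡ fromℕ m
  count-sum {m} P = begin
      sumF (count P)                      ≡⟨ sumF-cong (λ i → sym (*-identityʳ (count P i))) ⟩
      sumF (λ i → count P i * 1ℚ)         ≡⟨ sym (sumF-byLabel P (λ _ → 1ℚ)) ⟩
      sumF {m} (λ _ → 1ℚ)                 ≡⟨ sumF-const {m} 1ℚ ⟩
      fromℕ m * 1ℚ                        ≡⟨ *-identityʳ (fromℕ m) ⟩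
      fromℕ m                             ∎
    where open ≡-Reasoning

  count≤0⇒≢ : ∀ {m k} (P : Fin m → Fin k) i → count P i ≤ 0ℚ → ∀ x → ¬ (P x ≡ i)
  count≤0⇒≢ P i count≤0 x Px≡i = <⇒≱ (positive⁻¹ 1ℚ) (begin
      1ℚ          ≡⟨ sym (trans (cong (λ b → δ b i) Px≡i) (δ-diag i)) ⟩
      δ (P x) i   ≤⟨ term≤sumF (λ y → δ-nonNeg (P y) i) x ⟩
      count P i   ≤⟨ count≤0 ⟩
      0ℚ          ∎)
    where open ≤-Reasoning

  fromℕ-size : ∀ {d n k} (X : Fin n → Point d) (a : Fin n → Fin k) i → fromℕ (size X a i) ≡ count a i
  fromℕ-size {n = zero} X a i = sym (sumF-0 {0})
  fromℕ-size {n = suc n} X a i with a zero Fin.≟ i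
  ... | yes a0≡i = cong₂ _+_ (sym (trans (cong (λ b → δ b i) a0≡i) (δ-diag i)))
                      (fromℕ-size (λ y → X (suc y)) (λ y → a (suc y)) i)
  ... | no a0≢i = trans (fromℕ-size (λ y → X (suc y)) (λ y → a (suc y)) i)
                    (sym (trans (cong (_+ count (λ y → a (suc y)) i) (δ-≢ a0≢i)) (+-identityˡ _)))

  ≡-moduloRecip : ∀ N r → N * r ≡ 1ℚ → ∀ {L} R D → L ≡ R + (1ℚ - N * r) * D → L ≡ R
  ≡-moduloRecip N r N*r≡1 R D eq = trans eq (trans (cong (λ m → R + (1ℚ - m) * D) N*r≡1)
    (solve 2 (λ R D → R :+ (con 1ℚ :- con 1ℚ) :* D := R) refl R D))

  -- Completing the square: the gap is (N y - 1)² / N.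
  1-recip≤parabola : ∀ N y → 0ℚ < N → 1ℚ - recip N ≤ N * sq y + (1ℚ - two * y)
  1-recip≤parabola N y 0<N =
    ≤-byGap (r * sq (N * y - 1ℚ)) (*-nonNeg (recip-nonNeg N (<⇒≤ 0<N)) (0≤sq (N * y - 1ℚ)))
      (≡-moduloRecip N r (*-recip N (pos⇒≢0 0<N)) _ (N * sq y - two * y)
        (solve 3 (λ N y r → N :* (y :* y) :+ (con 1ℚ :- (con 1ℚ :+ con 1ℚ) :* y)
           := ((con 1ℚ :- r) :+ r :* ((N :* y :- con 1ℚ) :* (N :* y :- con 1ℚ)))
              :+ (con 1ℚ :- N :* r) :* (N :* (y :* y) :- (con 1ℚ :+ con 1ℚ) :* y)) refl N y r))
    where r = recip N

  -- The variance of masses t at h and u at 0; the gap is ((t + u) z - t h)² / (t + u).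
  twoMasses-cost≥ : ∀ h t u z → 0ℚ ≤ t → 0ℚ ≤ u →
    t * u * sq h * recip (t + u) ≤ t * sq (h - z) + u * sq (0ℚ - z)
  twoMasses-cost≥ h t u z 0≤t 0≤u = byCases (t + u ℚ.≟ 0ℚ)
    where
    r = recip (t + u)
    byCases : Dec (t + u ≡ 0ℚ) → t * u * sq h * r ≤ t * sq (h - z) + u * sq (0ℚ - z)
    byCases (yes t+u≡0) = begin
      t * u * sq h * r                  ≡⟨ cong (t * u * sq h *_) (recip-0 _ t+u≡0) ⟩
      t * u * sq h * 0ℚ                 ≡⟨ *-zeroʳ (t * u * sq h) ⟩
      0ℚ                                ≤⟨ +-nonNeg (*-nonNeg 0≤t (0≤sq (h - z))) (*-nonNeg 0≤u (0≤sq (0ℚ - z))) ⟩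
      t * sq (h - z) + u * sq (0ℚ - z)  ∎
      where open ≤-Reasoning
    byCases (no t+u≢0) =
      ≤-byGap (r * sq ((t + u) * z - t * h)) (*-nonNeg (recip-nonNeg (t + u) (+-nonNeg 0≤t 0≤u)) (0≤sq ((t + u) * z - t * h)))
        (≡-moduloRecip (t + u) r (*-recip (t + u) t+u≢0) _ (t * sq (h - z) + u * sq (0ℚ - z))
          (solve 5 (λ h t u z r → t :* ((h :- z) :* (h :- z)) :+ u :* ((con 0ℚ :- z) :* (con 0ℚ :- z))
             := (t :* u :* (h :* h) :* r :+ r :* (((t :+ u) :* z :- t :* h) :* ((t :+ u) :* z :- t :* h)))
                :+ (con 1ℚ :- (t :+ u) :* r) :* (t :* ((h :- z) :* (h :- z)) :+ u :* ((con 0ℚ :- z) :* (con 0ℚ :- z))))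
             refl h t u z r))

  excess : ℚ → ℚ → ℚ → ℚ → ℚ
  excess α₀ β₀ α₁ β₁ = 1ℚ + α₀ * (β₀ - 1ℚ) + α₁ * (β₁ - 1ℚ)

  excess-swap : ∀ α₀ β₀ α₁ β₁ → excess α₀ β₀ α₁ β₁ ≡ excess α₁ β₁ α₀ β₀
  excess-swap = solve 4 (λ α₀ β₀ α₁ β₁ → con 1ℚ :+ α₀ :* (β₀ :- con 1ℚ) :+ α₁ :* (β₁ :- con 1ℚ)
                                       := con 1ℚ :+ α₁ :* (β₁ :- con 1ℚ) :+ α₀ :* (β₀ :- con 1ℚ)) refl

  excess≡ : ∀ α₀ β₀ α₁ β₁ → excess α₀ β₀ α₁ β₁ ≡ α₀ * (β₀ - 1ℚ) + (1ℚ - α₁) + α₁ * β₁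
  excess≡ = solve 4 (λ α₀ β₀ α₁ β₁ → con 1ℚ :+ α₀ :* (β₀ :- con 1ℚ) :+ α₁ :* (β₁ :- con 1ℚ)
                                   := α₀ :* (β₀ :- con 1ℚ) :+ (con 1ℚ :- α₁) :+ α₁ :* β₁) refl

  module _ {α₀ β₀ α₁ β₁ : ℚ} (0≤α₀ : 0ℚ ≤ α₀) (0≤α₁ : 0ℚ ≤ α₁) (α₁≤1 : α₁ ≤ 1ℚ) (0≤β₁ : 0ℚ ≤ β₁) where

    excess-nonNeg-if-1≤β₀ : 1ℚ ≤ β₀ → 0ℚ ≤ excess α₀ β₀ α₁ β₁
    excess-nonNeg-if-1≤β₀ 1≤β₀ = subst (0ℚ ≤_) (sym (excess≡ α₀ β₀ α₁ β₁))
      (+-nonNeg (+-nonNeg (*-nonNeg 0≤α₀ (p≤q⇒0≤q-p 1≤β₀)) (p≤q⇒0≤q-p α₁≤1)) (*-nonNeg 0≤α₁ 0≤β₁))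

    excess≤0-if-1<β₀ : 1ℚ < β₀ → excess α₀ β₀ α₁ β₁ ≤ 0ℚ → (α₀ ≤ 0ℚ) × (β₁ ≤ 0ℚ)
    excess≤0-if-1<β₀ 1<β₀ e≤0 =
      pos*q≤0⇒q≤0 0<β₀-1 (subst (_≤ 0ℚ) (*-comm α₀ (β₀ - 1ℚ)) a≤0) ,
      pos*q≤0⇒q≤0 (<-≤-trans (positive⁻¹ 1ℚ) 1≤α₁) c≤0
      where
      0<β₀-1 : 0ℚ < β₀ - 1ℚ
      0<β₀-1 = ≤-<-trans (≤-reflexive (sym (+-inverseʳ 1ℚ))) (+-monoˡ-< (ℚ.- 1ℚ) 1<β₀)
      a = α₀ * (β₀ - 1ℚ)
      c = α₁ * β₁
      ab≤0 = nonNeg+nonNeg≤0 (+-nonNeg (*-nonNeg 0≤α₀ (<⇒≤ 0<β₀-1)) (p≤q⇒0≤q-p α₁≤1)) (*-nonNeg 0≤α₁ 0≤β₁)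
               (subst (_≤ 0ℚ) (excess≡ α₀ β₀ α₁ β₁) e≤0)
      c≤0 = proj₂ ab≤0
      a,b≤0 = nonNeg+nonNeg≤0 (*-nonNeg 0≤α₀ (<⇒≤ 0<β₀-1)) (p≤q⇒0≤q-p α₁≤1) (proj₁ ab≤0)
      a≤0 = proj₁ a,b≤0
      1≤α₁ : 1ℚ ≤ α₁
      1≤α₁ = ≤-trans (≤-reflexive (solve 1 (λ α → con 1ℚ := α :+ (con 1ℚ :- α)) refl α₁))
               (≤-trans (+-monoʳ-≤ α₁ (proj₂ a,b≤0)) (≤-reflexive (+-identityʳ α₁)))

  module _ {α₀ β₀ α₁ β₁ : ℚ} (0≤α₀ : 0ℚ ≤ α₀) (α₀≤1 : α₀ ≤ 1ℚ) (0≤α₁ : 0ℚ ≤ α₁) (α₁≤1 : α₁ ≤ 1ℚ)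
           (0≤β₀ : 0ℚ ≤ β₀) (0≤β₁ : 0ℚ ≤ β₁) (2<β₀+β₁ : two < β₀ + β₁) where

    private
      β₀≤1⇒1<β₁ : β₀ ≤ 1ℚ → 1ℚ < β₁
      β₀≤1⇒1<β₁ β₀≤1 = ≰⇒> (λ β₁≤1 → <⇒≱ 2<β₀+β₁ (+-mono-≤ β₀≤1 β₁≤1))

    excess-nonNeg : 0ℚ ≤ excess α₀ β₀ α₁ β₁
    excess-nonNeg with ≤-total 1ℚ β₀
    ... | inj₁ 1≤β₀ = excess-nonNeg-if-1≤β₀ 0≤α₀ 0≤α₁ α₁≤1 0≤β₁ 1≤β₀
    ... | inj₂ β₀≤1 = subst (0ℚ ≤_) (excess-swap α₁ β₁ α₀ β₀)
            (excess-nonNeg-if-1≤β₀ 0≤α₁ 0≤α₀ α₀≤1 0≤β₀ (<⇒≤ (β₀≤1⇒1<β₁ β₀≤1)))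

    excess≤0⇒degenerate : excess α₀ β₀ α₁ β₁ ≤ 0ℚ → ((α₀ ≤ 0ℚ) × (β₁ ≤ 0ℚ)) ⊎ ((α₁ ≤ 0ℚ) × (β₀ ≤ 0ℚ))
    excess≤0⇒degenerate e≤0 with <-cmp 1ℚ β₀
    ... | tri< 1<β₀ _ _ = inj₁ (excess≤0-if-1<β₀ 0≤α₀ 0≤α₁ α₁≤1 0≤β₁ 1<β₀ e≤0)
    ... | tri≈ _ 1≡β₀ _ = inj₂ (swapped (≤-reflexive (sym 1≡β₀)))
      where swapped = λ β₀≤1 → excess≤0-if-1<β₀ 0≤α₁ 0≤α₀ α₀≤1 0≤β₀ (β₀≤1⇒1<β₁ β₀≤1) (subst (_≤ 0ℚ) (excess-swap α₀ β₀ α₁ β₁) e≤0)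
    ... | tri> _ _ β₀<1 = inj₂ (excess≤0-if-1<β₀ 0≤α₁ 0≤α₀ α₀≤1 0≤β₀ (β₀≤1⇒1<β₁ (<⇒≤ β₀<1)) (subst (_≤ 0ℚ) (excess-swap α₀ β₀ α₁ β₁) e≤0))

  sqDist-coords : ∀ {d} (x y : Vec ℚ d) → sqDist x y ≡ sumF (λ k → sq (lookup x k - lookup y k))
  sqDist-coords [] [] = refl
  sqDist-coords (a ∷ x) (b ∷ y) = cong (sq (a - b) +_) (sqDist-coords x y)

  sqDist-nonNeg : ∀ {d} (x y : Vec ℚ d) → 0ℚ ≤ sqDist x y
  sqDist-nonNeg x y = subst (0ℚ ≤_) (sym (sqDist-coords x y))
    (sumF-nonNeg (λ k → 0≤sq (lookup x k - lookup y k)))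

  sqDist-self : ∀ {d} (x : Vec ℚ d) → sqDist x x ≡ 0ℚ
  sqDist-self [] = refl
  sqDist-self (a ∷ x) = trans (cong₂ _+_ (cong sq (+-inverseʳ a)) (sqDist-self x)) (+-identityˡ 0ℚ)

  head∷tail : ∀ {n} (u : Vec ℚ (suc n)) → u ≡ Vec.head u ∷ Vec.tail u
  head∷tail (_ ∷ _) = refl

  0F 1F : Fin 2
  0F = zero
  1F = suc zero

  other : Fin 2 → Fin 2
  other zero = 1F
  other (suc zero) = 0F

  other-involutive : ∀ i → other (other i) ≡ i
  other-involutive zero = refl
  other-involutive (suc zero) = refl

  other-≢ : ∀ i → ¬ (other i ≡ i)
  other-≢ zero ()
  other-≢ (suc zero) ()

  ≢⇒other : ∀ {a i : Fin 2} → ¬ (a ≡ i) → a ≡ other i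
  ≢⇒other {zero} {zero} a≢i = ⊥-elim (a≢i refl)
  ≢⇒other {zero} {suc zero} _ = refl
  ≢⇒other {suc zero} {zero} _ = refl
  ≢⇒other {suc zero} {suc zero} a≢i = ⊥-elim (a≢i refl)

  count≤0⇒other : ∀ {m} (P : Fin m → Fin 2) i → count P i ≤ 0ℚ → ∀ x → P x ≡ other i
  count≤0⇒other P i count≤0 x = ≢⇒other (count≤0⇒≢ P i count≤0 x)

  sumF-byLabel₂ : ∀ {m} (P : Fin m → Fin 2) (g : Fin 2 → ℚ) →
    sumF (λ x → g (P x)) ≡ count P 0F * g 0F + count P 1F * g 1F
  sumF-byLabel₂ P g = trans (sumF-byLabel P g) (sumF-Fin2 (λ i → count P i * g i))

  count₂-sum : ∀ {m} (P : Fin m → Fin 2) → count P 0F + count P 1F ≡ fromℕ m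
  count₂-sum P = trans (sym (sumF-Fin2 (count P))) (count-sum P)

  term≤sum₂ : ∀ (g : Fin 2 → ℚ) → (∀ i → 0ℚ ≤ g i) → ∀ i → g i ≤ g 0F + g 1F
  term≤sum₂ g 0≤g zero = ≤-byGap (g 1F) (0≤g 1F) refl
  term≤sum₂ g 0≤g (suc zero) = ≤-byGap (g 0F) (0≤g 0F) (+-comm (g 0F) (g 1F))

  ↑ˡ-or-↑ʳ : ∀ m {n} (x : Fin (m ℕ.+ n)) → (Σ (Fin m) λ l → l ↑ˡ n ≡ x) ⊎ (Σ (Fin n) λ y → m ↑ʳ y ≡ x)
  ↑ˡ-or-↑ʳ m x with Fin.splitAt m x in eq
  ... | inj₁ l = inj₁ (l , splitAt⁻¹-↑ˡ eq)
  ... | inj₂ y = inj₂ (y , splitAt⁻¹-↑ʳ eq)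

  minF₂-at : ∀ (f : Fin 2 → ℚ) b → (∀ l → f b ≤ f l) → minF f ≡ f b
  minF₂-at f zero fb≤ = p≤q⇒p⊓q≡p (fb≤ 1F)
  minF₂-at f (suc zero) fb≤ = p≥q⇒p⊓q≡q (fb≤ 0F)

  argminF₂ : ∀ (f : Fin 2 → ℚ) → Σ (Fin 2) (λ b → minF f ≡ f b)
  argminF₂ f with ≤-total (f 0F) (f 1F)
  ... | inj₁ f₀≤f₁ = 0F , p≤q⇒p⊓q≡p f₀≤f₁
  ... | inj₂ f₁≤f₀ = 1F , p≥q⇒p⊓q≡q f₁≤f₀

  deletionCost₂ : ∀ {d n} (X : Fin n → Point d) (C : Fin 2 → Point d) (a : Fin n → Fin 2) →
    deletionCost X C a 0F 1F ≡ sumF (λ x → sqDist (X x) (C 1F))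
  deletionCost₂ {n = zero} X C a = refl
  deletionCost₂ {n = suc n} X C a with a zero
  ... | zero = cong (sqDist (X zero) (C 1F) +_) (deletionCost₂ (λ y → X (suc y)) C (λ y → a (suc y)))
  ... | suc zero = cong (sqDist (X zero) (C 1F) +_) (deletionCost₂ (λ y → X (suc y)) C (λ y → a (suc y)))

  module Instance (h : ℚ) (s w : ℕ) where

    e : Fin s → Vec ℚ s
    e l = tabulate (λ k → δ k l)

    q : Fin s → Point (suc s)
    q l = h ∷ e l

    O : Point (suc s)
    O = 0ℚ ∷ replicate s 0ℚ

    points : Fin s ⊎ Fin w → Point (suc s)
    points (inj₁ l) = q l
    points (inj₂ _) = O

    X : Fin (s ℕ.+ w) → Point (suc s)
    X x = points (Fin.splitAt s x)

    X-q : ∀ l → X (l ↑ˡ w) ≡ q l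
    X-q l = cong points (splitAt-↑ˡ s l w)

    X-O : ∀ y → X (s ↑ʳ y) ≡ O
    X-O y = cong points (splitAt-↑ʳ s w y)

    sumF-X : ∀ (g : Fin s ⊎ Fin w → ℚ) → sumF (λ x → g (Fin.splitAt s x)) ≡ sumF (λ l → g (inj₁ l)) + sumF (λ y → g (inj₂ y))
    sumF-X g = trans (sumF-++ s (λ x → g (Fin.splitAt s x)))
      (cong₂ _+_ (sumF-cong (λ l → cong g (splitAt-↑ˡ s l w))) (sumF-cong (λ y → cong g (splitAt-↑ʳ s w y))))

    sqDist-e : ∀ l (u : Vec ℚ s) → sqDist (e l) u ≡ sumF (λ k → sq (δ k l - lookup u k))
    sqDist-e l u = trans (sqDist-coords (e l) u)
      (sumF-cong (λ k → cong (λ a → sq (a - lookup u k)) (lookup∘tabulate (λ k → δ k l) k)))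

    sqDist-0 : ∀ (u : Vec ℚ s) → sqDist (replicate s 0ℚ) u ≡ sumF (λ k → sq (0ℚ - lookup u k))
    sqDist-0 u = trans (sqDist-coords (replicate s 0ℚ) u)
      (sumF-cong (λ k → cong (λ a → sq (a - lookup u k)) (lookup-replicate k 0ℚ)))

    module Assignment (P : Fin (s ℕ.+ w) → Fin 2) (z : Fin 2 → ℚ) (v : Fin 2 → Vec ℚ s) where

      labelQ : Fin s → Fin 2
      labelQ l = P (l ↑ˡ w)

      labelO : Fin w → Fin 2
      labelO y = P (s ↑ʳ y)

      nq nO : Fin 2 → ℚ
      nq = count labelQ
      nO = count labelO

      vc : Fin 2 → Fin s → ℚ
      vc i k = lookup (v i) k

      assignedCost : ℚ
      assignedCost = sumF (λ x → sqDist (X x) (z (P x) ∷ v (P x)))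

      heightCost : ℚ
      heightCost = (nq 0F * sq (h - z 0F) + nq 1F * sq (h - z 1F)) + (nO 0F * sq (0ℚ - z 0F) + nO 1F * sq (0ℚ - z 1F))

      coordCost : Fin s → ℚ
      coordCost k = ((nq 0F * sq (vc 0F k) + nq 1F * sq (vc 1F k)) + (1ℚ - two * vc (labelQ k) k))
                    + (nO 0F * sq (0ℚ - vc 0F k) + nO 1F * sq (0ℚ - vc 1F k))

      private
        qCoordCost : Fin s → ℚ
        qCoordCost k = sumF (λ l → sq (δ k l - vc (labelQ l) k))

        oCoordCost : Fin s → ℚ
        oCoordCost k = sumF (λ y → sq (0ℚ - vc (labelO y) k))

        qCoordCost≡ : ∀ k → qCoordCost k ≡ (nq 0F * sq (vc 0F k) + nq 1F * sq (vc 1F k)) + (1ℚ - two * vc (labelQ k) k)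
        qCoordCost≡ k = begin
          sumF (λ l → sq (δ k l - vc (labelQ l) k))
            ≡⟨ sumF-cong (λ l → sq-δ- k l (vc (labelQ l) k)) ⟩
          sumF (λ l → sq (vc (labelQ l) k) + δ k l * (1ℚ - two * vc (labelQ l) k))
            ≡⟨ sumF-+ (λ l → sq (vc (labelQ l) k)) (λ l → δ k l * (1ℚ - two * vc (labelQ l) k)) ⟩
          sumF (λ l → sq (vc (labelQ l) k)) + sumF (λ l → δ k l * (1ℚ - two * vc (labelQ l) k))
            ≡⟨ cong₂ _+_ (sumF-byLabel₂ labelQ (λ i → sq (vc i k))) (sumF-δ k (λ l → 1ℚ - two * vc (labelQ l) k)) ⟩
          (nq 0F * sq (vc 0F k) + nq 1F * sq (vc 1F k)) + (1ℚ - two * vc (labelQ k) k) ∎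
          where open ≡-Reasoning

        qCost : sumF (λ l → sqDist (X (l ↑ˡ w)) (z (labelQ l) ∷ v (labelQ l)))
                ≡ (nq 0F * sq (h - z 0F) + nq 1F * sq (h - z 1F)) + sumF qCoordCost
        qCost = begin
          sumF (λ l → sqDist (X (l ↑ˡ w)) (z (labelQ l) ∷ v (labelQ l)))
            ≡⟨ sumF-cong (λ l → cong (λ p → sqDist p (z (labelQ l) ∷ v (labelQ l))) (X-q l)) ⟩
          sumF (λ l → sq (h - z (labelQ l)) + sqDist (e l) (v (labelQ l)))
            ≡⟨ sumF-+ (λ l → sq (h - z (labelQ l))) (λ l → sqDist (e l) (v (labelQ l))) ⟩
          sumF (λ l → sq (h - z (labelQ l))) + sumF (λ l → sqDist (e l) (v (labelQ l)))
            ≡⟨ cong₂ _+_ (sumF-byLabel₂ labelQ (λ i → sq (h - z i)))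
                         (trans (sumF-cong (λ l → sqDist-e l (v (labelQ l)))) (sumF-swap (λ l k → sq (δ k l - vc (labelQ l) k)))) ⟩
          (nq 0F * sq (h - z 0F) + nq 1F * sq (h - z 1F)) + sumF qCoordCost ∎
          where open ≡-Reasoning

        oCost : sumF (λ y → sqDist (X (s ↑ʳ y)) (z (labelO y) ∷ v (labelO y)))
                ≡ (nO 0F * sq (0ℚ - z 0F) + nO 1F * sq (0ℚ - z 1F)) + sumF oCoordCost
        oCost = begin
          sumF (λ y → sqDist (X (s ↑ʳ y)) (z (labelO y) ∷ v (labelO y)))
            ≡⟨ sumF-cong (λ y → cong (λ p → sqDist p (z (labelO y) ∷ v (labelO y))) (X-O y)) ⟩
          sumF (λ y → sq (0ℚ - z (labelO y)) + sqDist (replicate s 0ℚ) (v (labelO y)))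
            ≡⟨ sumF-+ (λ y → sq (0ℚ - z (labelO y))) (λ y → sqDist (replicate s 0ℚ) (v (labelO y))) ⟩
          sumF (λ y → sq (0ℚ - z (labelO y))) + sumF (λ y → sqDist (replicate s 0ℚ) (v (labelO y)))
            ≡⟨ cong₂ _+_ (sumF-byLabel₂ labelO (λ i → sq (0ℚ - z i)))
                         (trans (sumF-cong (λ y → sqDist-0 (v (labelO y)))) (sumF-swap (λ y k → sq (0ℚ - vc (labelO y) k)))) ⟩
          (nO 0F * sq (0ℚ - z 0F) + nO 1F * sq (0ℚ - z 1F)) + sumF oCoordCost ∎
          where open ≡-Reasoning

      assignedCost≡ : assignedCost ≡ heightCost + sumF coordCost
      assignedCost≡ = begin
        assignedCost
          ≡⟨ sumF-++ s (λ x → sqDist (X x) (z (P x) ∷ v (P x))) ⟩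
        sumF (λ l → sqDist (X (l ↑ˡ w)) (z (labelQ l) ∷ v (labelQ l))) + sumF (λ y → sqDist (X (s ↑ʳ y)) (z (labelO y) ∷ v (labelO y)))
          ≡⟨ cong₂ _+_ qCost oCost ⟩
        (hq + sumF qCoordCost) + (ho + sumF oCoordCost)
          ≡⟨ solve 4 (λ a b c d → (a :+ b) :+ (c :+ d) := (a :+ c) :+ (b :+ d)) refl hq (sumF qCoordCost) ho (sumF oCoordCost) ⟩
        heightCost + (sumF qCoordCost + sumF oCoordCost)
          ≡⟨ cong (heightCost +_) (trans (sym (sumF-+ qCoordCost oCoordCost))
               (sumF-cong (λ k → cong₂ _+_ (qCoordCost≡ k) (sumF-byLabel₂ labelO (λ i → sq (0ℚ - vc i k)))))) ⟩
        heightCost + sumF coordCost ∎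
        where
        open ≡-Reasoning
        hq = nq 0F * sq (h - z 0F) + nq 1F * sq (h - z 1F)
        ho = nO 0F * sq (0ℚ - z 0F) + nO 1F * sq (0ℚ - z 1F)

      r : Fin 2 → ℚ
      r i = recip (nq i + nO i)

      nq-nonNeg : ∀ i → 0ℚ ≤ nq i
      nq-nonNeg = count-nonNeg labelQ

      nO-nonNeg : ∀ i → 0ℚ ≤ nO i
      nO-nonNeg = count-nonNeg labelO

      1≤nq-labelQ : ∀ k → 1ℚ ≤ nq (labelQ k)
      1≤nq-labelQ k = subst (_≤ nq (labelQ k)) (δ-diag (labelQ k)) (term≤sumF (λ l → δ-nonNeg (labelQ l) (labelQ k)) k)

      -- Coordinate k is 1 only at q k, whose cluster has nq + nO points.
      coordCost≥ : ∀ k → 1ℚ - r (labelQ k) ≤ coordCost k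
      coordCost≥ k = begin
          1ℚ - r j
            ≤⟨ 1-recip≤parabola (nq j + nO j) y (<-≤-trans (positive⁻¹ 1ℚ) (≤-trans (1≤nq-labelQ k) (≤-byGap (nO j) (nO-nonNeg j) refl))) ⟩
          (nq j + nO j) * sq y + (1ℚ - two * y)
            ≡⟨ solve 4 (λ a b y c → (a :+ b) :* (y :* y) :+ c := (a :* (y :* y) :+ c) :+ b :* ((con 0ℚ :- y) :* (con 0ℚ :- y)))
                 refl (nq j) (nO j) y (1ℚ - two * y) ⟩
          (nq j * sq y + (1ℚ - two * y)) + nO j * sq (0ℚ - y)
            ≤⟨ +-mono-≤ (+-monoˡ-≤ (1ℚ - two * y) (term≤sum₂ (λ i → nq i * sq (vc i k)) (λ i → *-nonNeg (nq-nonNeg i) (0≤sq (vc i k))) j))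
                        (term≤sum₂ (λ i → nO i * sq (0ℚ - vc i k)) (λ i → *-nonNeg (nO-nonNeg i) (0≤sq (0ℚ - vc i k))) j) ⟩
          coordCost k ∎
        where
        open ≤-Reasoning
        j = labelQ k
        y = vc j k

      lowerBound : ℚ
      lowerBound = (nq 0F * nO 0F * sq h * r 0F + nq 1F * nO 1F * sq h * r 1F)
                   + (nq 0F * (1ℚ - r 0F) + nq 1F * (1ℚ - r 1F))

      lowerBound≤assignedCost : lowerBound ≤ assignedCost
      lowerBound≤assignedCost = begin
        lowerBound
          ≤⟨ +-mono-≤ (+-mono-≤ (twoMasses-cost≥ h (nq 0F) (nO 0F) (z 0F) (nq-nonNeg 0F) (nO-nonNeg 0F))
                                (twoMasses-cost≥ h (nq 1F) (nO 1F) (z 1F) (nq-nonNeg 1F) (nO-nonNeg 1F)))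
                      (≤-trans (≤-reflexive (sym (sumF-byLabel₂ labelQ (λ i → 1ℚ - r i)))) (sumF-mono coordCost≥)) ⟩
        (a₀ + b₀) + (a₁ + b₁) + sumF coordCost
          ≡⟨ cong (_+ sumF coordCost) (solve 4 (λ a b c d → (a :+ c) :+ (b :+ d) := (a :+ b) :+ (c :+ d)) refl a₀ a₁ b₀ b₁) ⟩
        heightCost + sumF coordCost
          ≡⟨ sym assignedCost≡ ⟩
        assignedCost ∎
        where
        open ≤-Reasoning
        a₀ = nq 0F * sq (h - z 0F)
        a₁ = nq 1F * sq (h - z 1F)
        b₀ = nO 0F * sq (0ℚ - z 0F)
        b₁ = nO 1F * sq (0ℚ - z 1F)

      IsSplit : Fin 2 → Set
      IsSplit i = (∀ l → labelQ l ≡ other i) × (∀ y → labelO y ≡ i)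

      module _ (0<h² : 0ℚ < sq h) (2<wh² : two < fromℕ w * sq h) where

        α β : Fin 2 → ℚ
        α i = nq i * r i
        β i = nO i * sq h

        private
          nq≤nq+nO : ∀ i → nq i ≤ nq i + nO i
          nq≤nq+nO i = ≤-byGap (nO i) (nO-nonNeg i) refl

        α-nonNeg : ∀ i → 0ℚ ≤ α i
        α-nonNeg i = *-nonNeg (nq-nonNeg i) (recip-nonNeg _ (+-nonNeg (nq-nonNeg i) (nO-nonNeg i)))

        α≤1 : ∀ i → α i ≤ 1ℚ
        α≤1 i = byCases ((nq i + nO i) ℚ.≟ 0ℚ)
          where
          byCases : Dec (nq i + nO i ≡ 0ℚ) → α i ≤ 1ℚ
          byCases (yes n≡0) = ≤-trans (≤-reflexive (trans (cong (nq i *_) (recip-0 _ n≡0)) (*-zeroʳ (nq i)))) 0≤1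
          byCases (no n≢0) = ≤-trans (*-monoʳ-≤-nonNeg (r i) {{ℚ.nonNegative (recip-nonNeg _ (+-nonNeg (nq-nonNeg i) (nO-nonNeg i)))}} (nq≤nq+nO i))
                                     (≤-reflexive (*-recip (nq i + nO i) n≢0))

        α≤0⇒nq≤0 : ∀ i → α i ≤ 0ℚ → nq i ≤ 0ℚ
        α≤0⇒nq≤0 i α≤0 = ≮⇒≥ (λ 0<nq → <⇒≱ (*-pos 0<nq (recip-pos _ (<-≤-trans 0<nq (nq≤nq+nO i)))) α≤0)

        β-nonNeg : ∀ i → 0ℚ ≤ β i
        β-nonNeg i = *-nonNeg (nO-nonNeg i) (<⇒≤ 0<h²)

        β≤0⇒nO≤0 : ∀ i → β i ≤ 0ℚ → nO i ≤ 0ℚ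
        β≤0⇒nO≤0 i β≤0 = pos*q≤0⇒q≤0 0<h² (subst (_≤ 0ℚ) (*-comm (nO i) (sq h)) β≤0)

        2<β₀+β₁ : two < β 0F + β 1F
        2<β₀+β₁ = <-≤-trans 2<wh² (≤-reflexive (trans (cong (_* sq h) (sym (count₂-sum labelO))) (*-distribʳ-+ (sq h) (nO 0F) (nO 1F))))

        lowerBound≡ : lowerBound ≡ (fromℕ s - 1ℚ) + excess (α 0F) (β 0F) (α 1F) (β 1F)
        lowerBound≡ = begin
          lowerBound
            ≡⟨ solve 4 (λ x₀ x₁ y₀ y₁ → (x₀ :+ x₁) :+ (y₀ :+ y₁) := (x₀ :+ y₀) :+ (x₁ :+ y₁)) refl
                 (nq 0F * nO 0F * sq h * r 0F) (nq 1F * nO 1F * sq h * r 1F) (nq 0F * (1ℚ - r 0F)) (nq 1F * (1ℚ - r 1F)) ⟩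
          (nq 0F * nO 0F * sq h * r 0F + nq 0F * (1ℚ - r 0F)) + (nq 1F * nO 1F * sq h * r 1F + nq 1F * (1ℚ - r 1F))
            ≡⟨ cong₂ _+_ (perLabel 0F) (perLabel 1F) ⟩
          (nq 0F + α 0F * (β 0F - 1ℚ)) + (nq 1F + α 1F * (β 1F - 1ℚ))
            ≡⟨ solve 4 (λ t₀ t₁ p₀ p₁ → (t₀ :+ p₀) :+ (t₁ :+ p₁) := ((t₀ :+ t₁) :- con 1ℚ) :+ (con 1ℚ :+ p₀ :+ p₁)) refl
                 (nq 0F) (nq 1F) (α 0F * (β 0F - 1ℚ)) (α 1F * (β 1F - 1ℚ)) ⟩
          ((nq 0F + nq 1F) - 1ℚ) + excess (α 0F) (β 0F) (α 1F) (β 1F)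
            ≡⟨ cong (λ m → (m - 1ℚ) + excess (α 0F) (β 0F) (α 1F) (β 1F)) (count₂-sum labelQ) ⟩
          (fromℕ s - 1ℚ) + excess (α 0F) (β 0F) (α 1F) (β 1F) ∎
          where
          open ≡-Reasoning
          perLabel : ∀ i → nq i * nO i * sq h * r i + nq i * (1ℚ - r i) ≡ nq i + α i * (β i - 1ℚ)
          perLabel i = solve 4 (λ t u hh r → t :* u :* hh :* r :+ t :* (con 1ℚ :- r) := t :+ (t :* r) :* (u :* hh :- con 1ℚ))
                         refl (nq i) (nO i) (sq h) (r i)

        s-1≤assignedCost : fromℕ s - 1ℚ ≤ assignedCost
        s-1≤assignedCost = ≤-trans
          (≤-byGap _ (excess-nonNeg (α-nonNeg 0F) (α≤1 0F) (α-nonNeg 1F) (α≤1 1F) (β-nonNeg 0F) (β-nonNeg 1F) 2<β₀+β₁) refl)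
          (≤-trans (≤-reflexive (sym lowerBound≡)) lowerBound≤assignedCost)

        excess≤0-if-assignedCost≤s-1 : assignedCost ≤ fromℕ s - 1ℚ → excess (α 0F) (β 0F) (α 1F) (β 1F) ≤ 0ℚ
        excess≤0-if-assignedCost≤s-1 cost≤ = +-cancelˡ-≤ (fromℕ s - 1ℚ) (begin
          (fromℕ s - 1ℚ) + excess (α 0F) (β 0F) (α 1F) (β 1F)   ≡⟨ sym lowerBound≡ ⟩
          lowerBound                                             ≤⟨ lowerBound≤assignedCost ⟩
          assignedCost                                           ≤⟨ cost≤ ⟩
          fromℕ s - 1ℚ                                           ≡⟨ sym (+-identityʳ _) ⟩
          (fromℕ s - 1ℚ) + 0ℚ                                    ∎)
          where open ≤-Reasoning

        assignedCost≤s-1⇒split : assignedCost ≤ fromℕ s - 1ℚ → IsSplit 0F ⊎ IsSplit 1F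
        assignedCost≤s-1⇒split cost≤ = fromDegenerate
          (excess≤0⇒degenerate (α-nonNeg 0F) (α≤1 0F) (α-nonNeg 1F) (α≤1 1F) (β-nonNeg 0F) (β-nonNeg 1F) 2<β₀+β₁
             (excess≤0-if-assignedCost≤s-1 cost≤))
          where
          fromDegenerate : ((α 0F ≤ 0ℚ) × (β 1F ≤ 0ℚ)) ⊎ ((α 1F ≤ 0ℚ) × (β 0F ≤ 0ℚ)) → IsSplit 0F ⊎ IsSplit 1F
          fromDegenerate (inj₁ (α₀≤0 , β₁≤0)) =
            inj₁ (count≤0⇒other labelQ 0F (α≤0⇒nq≤0 0F α₀≤0) , count≤0⇒other labelO 1F (β≤0⇒nO≤0 1F β₁≤0))
          fromDegenerate (inj₂ (α₁≤0 , β₀≤0)) =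
            inj₂ (count≤0⇒other labelQ 1F (α≤0⇒nq≤0 1F α₁≤0) , count≤0⇒other labelO 0F (β≤0⇒nO≤0 0F β₀≤0))

      module _ (0<s : 0ℚ < fromℕ s) (0<w : 0ℚ < fromℕ w) (i : Fin 2) (split : IsSplit i) where

        private
          j = other i

          nq-j : nq j ≡ fromℕ s
          nq-j = trans (count-const labelQ j (proj₁ split) j) (trans (cong (fromℕ s *_) (δ-diag j)) (*-identityʳ (fromℕ s)))

          nO-i : nO i ≡ fromℕ w
          nO-i = trans (count-const labelO i (proj₂ split) i) (trans (cong (fromℕ w *_) (δ-diag i)) (*-identityʳ (fromℕ w)))

          heightCost≥ : fromℕ s * sq (h - z j) ≤ heightCost
          heightCost≥ = begin
            fromℕ s * sq (h - z j)
              ≡⟨ cong (_* sq (h - z j)) (sym nq-j) ⟩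
            nq j * sq (h - z j)
              ≤⟨ term≤sum₂ (λ k → nq k * sq (h - z k)) (λ k → *-nonNeg (nq-nonNeg k) (0≤sq (h - z k))) j ⟩
            nq 0F * sq (h - z 0F) + nq 1F * sq (h - z 1F)
              ≤⟨ ≤-byGap _ (+-nonNeg (*-nonNeg (nO-nonNeg 0F) (0≤sq (0ℚ - z 0F))) (*-nonNeg (nO-nonNeg 1F) (0≤sq (0ℚ - z 1F)))) refl ⟩
            heightCost ∎
            where open ≤-Reasoning

          coordCost≥′ : ∀ k → (1ℚ - recip (fromℕ s)) + fromℕ w * sq (0ℚ - vc i k) ≤ coordCost k
          coordCost≥′ k = begin
            (1ℚ - recip (fromℕ s)) + fromℕ w * sq (0ℚ - vc i k)
              ≡⟨ cong₂ (λ n m → (1ℚ - recip n) + m * sq (0ℚ - vc i k)) (sym nq-j) (sym nO-i) ⟩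
            (1ℚ - recip (nq j)) + nO i * sq (0ℚ - vc i k)
              ≤⟨ +-monoˡ-≤ (nO i * sq (0ℚ - vc i k)) (1-recip≤parabola (nq j) (vc j k) (subst (0ℚ <_) (sym nq-j) 0<s)) ⟩
            (nq j * sq (vc j k) + (1ℚ - two * vc j k)) + nO i * sq (0ℚ - vc i k)
              ≤⟨ +-mono-≤ (+-monoˡ-≤ (1ℚ - two * vc j k) (term≤sum₂ (λ m → nq m * sq (vc m k)) (λ m → *-nonNeg (nq-nonNeg m) (0≤sq (vc m k))) j))
                          (term≤sum₂ (λ m → nO m * sq (0ℚ - vc m k)) (λ m → *-nonNeg (nO-nonNeg m) (0≤sq (0ℚ - vc m k))) i) ⟩
            ((nq 0F * sq (vc 0F k) + nq 1F * sq (vc 1F k)) + (1ℚ - two * vc j k)) + (nO 0F * sq (0ℚ - vc 0F k) + nO 1F * sq (0ℚ - vc 1F k))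
              ≡⟨ cong (λ p → ((nq 0F * sq (vc 0F k) + nq 1F * sq (vc 1F k)) + (1ℚ - two * vc p k)) + (nO 0F * sq (0ℚ - vc 0F k) + nO 1F * sq (0ℚ - vc 1F k)))
                      (sym (proj₁ split k)) ⟩
            coordCost k ∎
            where open ≤-Reasoning

          sumF-coordCost≥ : (fromℕ s - 1ℚ) + fromℕ w * sumF (λ k → sq (0ℚ - vc i k)) ≤ sumF coordCost
          sumF-coordCost≥ = begin
            (fromℕ s - 1ℚ) + fromℕ w * sumF (λ k → sq (0ℚ - vc i k))
              ≡⟨ cong₂ _+_ (sym s*[1-1/s]) (sym (sumF-*ˡ (fromℕ w) (λ k → sq (0ℚ - vc i k)))) ⟩
            fromℕ s * (1ℚ - recip (fromℕ s)) + sumF (λ k → fromℕ w * sq (0ℚ - vc i k))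
              ≡⟨ cong (_+ sumF (λ k → fromℕ w * sq (0ℚ - vc i k))) (sym (sumF-const {s} _)) ⟩
            sumF {s} (λ _ → 1ℚ - recip (fromℕ s)) + sumF (λ k → fromℕ w * sq (0ℚ - vc i k))
              ≡⟨ sym (sumF-+ (λ _ → 1ℚ - recip (fromℕ s)) (λ k → fromℕ w * sq (0ℚ - vc i k))) ⟩
            sumF (λ k → (1ℚ - recip (fromℕ s)) + fromℕ w * sq (0ℚ - vc i k))
              ≤⟨ sumF-mono coordCost≥′ ⟩
            sumF coordCost ∎
            where
            open ≤-Reasoning
            s*[1-1/s] : fromℕ s * (1ℚ - recip (fromℕ s)) ≡ fromℕ s - 1ℚ
            s*[1-1/s] = ≡-moduloRecip (fromℕ s) (recip (fromℕ s)) (*-recip (fromℕ s) (pos⇒≢0 0<s)) (fromℕ s - 1ℚ) 1ℚ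
              (solve 2 (λ n r → n :* (con 1ℚ :- r) := (n :- con 1ℚ) :+ (con 1ℚ :- n :* r) :* con 1ℚ) refl (fromℕ s) (recip (fromℕ s)))

        split-centres-pinned : assignedCost ≤ fromℕ s - 1ℚ →
          (sq (h - z (other i)) ≤ 0ℚ) × (∀ l → sq (0ℚ - vc i l) ≤ 0ℚ)
        split-centres-pinned cost≤ =
          pos*q≤0⇒q≤0 0<s (proj₁ both≤0) ,
          λ l → ≤-trans (term≤sumF (λ k → 0≤sq (0ℚ - vc i k)) l) (pos*q≤0⇒q≤0 0<w (proj₂ both≤0))
          where
          open ≤-Reasoning
          A = fromℕ s * sq (h - z j)
          B = fromℕ w * sumF (λ k → sq (0ℚ - vc i k))
          both≤0 = nonNeg+nonNeg≤0 (*-nonNeg (<⇒≤ 0<s) (0≤sq (h - z j)))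
                                   (*-nonNeg (<⇒≤ 0<w) (sumF-nonNeg (λ k → 0≤sq (0ℚ - vc i k))))
            (+-cancelˡ-≤ (fromℕ s - 1ℚ) (begin
              (fromℕ s - 1ℚ) + (A + B)
                ≡⟨ solve 3 (λ m a b → m :+ (a :+ b) := a :+ (m :+ b)) refl (fromℕ s - 1ℚ) A B ⟩
              A + ((fromℕ s - 1ℚ) + B)      ≤⟨ +-mono-≤ heightCost≥ sumF-coordCost≥ ⟩
              heightCost + sumF coordCost   ≡⟨ sym assignedCost≡ ⟩
              assignedCost                  ≤⟨ cost≤ ⟩
              fromℕ s - 1ℚ                  ≡⟨ sym (+-identityʳ _) ⟩
              (fromℕ s - 1ℚ) + 0ℚ           ∎))

    sqDist-O≥ : ∀ z (u : Vec ℚ s) → sq h ≤ two * sqDist O (z ∷ u) + two * sq (h - z)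
    sqDist-O≥ z u = begin
        sq h
          ≤⟨ ≤-byGap (sq (h - two * z)) (0≤sq (h - two * z))
               (solve 2 (λ h z → (con 1ℚ :+ con 1ℚ) :* ((con 0ℚ :- z) :* (con 0ℚ :- z)) :+ (con 1ℚ :+ con 1ℚ) :* ((h :- z) :* (h :- z))
                 := h :* h :+ (h :- (con 1ℚ :+ con 1ℚ) :* z) :* (h :- (con 1ℚ :+ con 1ℚ) :* z)) refl h z) ⟩
        two * sq (0ℚ - z) + two * sq (h - z)
          ≤⟨ +-monoˡ-≤ (two * sq (h - z)) (*-monoˡ-≤-nonNeg two {{_}}
               (≤-byGap {sq (0ℚ - z)} {sqDist O (z ∷ u)} (sqDist (replicate s 0ℚ) u) (sqDist-nonNeg (replicate s 0ℚ) u) refl)) ⟩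
        two * sqDist O (z ∷ u) + two * sq (h - z) ∎
      where open ≤-Reasoning

    sqDist-q≥ : ∀ l z (u : Vec ℚ s) → 1ℚ ≤ two * sqDist (q l) (z ∷ u) + two * sq (0ℚ - lookup u l)
    sqDist-q≥ l z u = begin
        1ℚ
          ≤⟨ ≤-byGap (sq (1ℚ - two * y)) (0≤sq (1ℚ - two * y))
               (solve 1 (λ y → (con 1ℚ :+ con 1ℚ) :* ((con 1ℚ :- y) :* (con 1ℚ :- y)) :+ (con 1ℚ :+ con 1ℚ) :* ((con 0ℚ :- y) :* (con 0ℚ :- y))
                 := con 1ℚ :+ (con 1ℚ :- (con 1ℚ :+ con 1ℚ) :* y) :* (con 1ℚ :- (con 1ℚ :+ con 1ℚ) :* y)) refl y) ⟩
        two * sq (1ℚ - y) + two * sq (0ℚ - y)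
          ≤⟨ +-monoˡ-≤ (two * sq (0ℚ - y)) (*-monoˡ-≤-nonNeg two {{_}} sq[1-y]≤) ⟩
        two * sqDist (q l) (z ∷ u) + two * sq (0ℚ - y) ∎
      where
      open ≤-Reasoning
      y = lookup u l
      sq[1-y]≤ : sq (1ℚ - y) ≤ sqDist (q l) (z ∷ u)
      sq[1-y]≤ = begin
        sq (1ℚ - y)                              ≡⟨ cong (λ d → sq (d - y)) (sym (δ-diag l)) ⟩
        sq (δ l l - y)                           ≤⟨ term≤sumF (λ k → 0≤sq (δ k l - lookup u k)) l ⟩
        sumF (λ k → sq (δ k l - lookup u k))     ≡⟨ sym (sqDist-e l u) ⟩
        sqDist (e l) u                           ≤⟨ ≤-byGap (sq (h - z)) (0≤sq (h - z)) (+-comm (sq (h - z)) (sqDist (e l) u)) ⟩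
        sq (h - z) + sqDist (e l) u              ∎

    sqDist-q-replicate : ∀ l z a → sqDist (q l) (z ∷ replicate s a) ≡ sq (h - z) + (fromℕ s * sq a + (1ℚ - two * a))
    sqDist-q-replicate l z a = cong (sq (h - z) +_) (begin
      sqDist (e l) (replicate s a)
        ≡⟨ sqDist-e l (replicate s a) ⟩
      sumF (λ k → sq (δ k l - lookup (replicate s a) k))
        ≡⟨ sumF-cong (λ k → trans (cong (λ b → sq (δ k l - b)) (lookup-replicate k a)) (sq-δ- k l a)) ⟩
      sumF (λ k → sq a + δ k l * (1ℚ - two * a))
        ≡⟨ sumF-+ (λ _ → sq a) (λ k → δ k l * (1ℚ - two * a)) ⟩
      sumF {s} (λ _ → sq a) + sumF (λ k → δ k l * (1ℚ - two * a))
        ≡⟨ cong₂ _+_ (sumF-const {s} (sq a))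
                     (trans (sumF-cong (λ k → cong (_* (1ℚ - two * a)) (δ-sym k l))) (sumF-δ l (λ _ → 1ℚ - two * a))) ⟩
      fromℕ s * sq a + (1ℚ - two * a) ∎)
      where open ≡-Reasoning

    sqDist-O-replicate : ∀ z a → sqDist O (z ∷ replicate s a) ≡ sq (0ℚ - z) + fromℕ s * sq a
    sqDist-O-replicate z a = cong (sq (0ℚ - z) +_)
      (trans (sqDist-0 (replicate s a))
        (trans (sumF-cong {s} (λ k → cong (λ b → sq (0ℚ - b)) (lookup-replicate k a)))
          (trans (sumF-const {s} (sq (0ℚ - a))) (cong (fromℕ s *_) (solve 1 (λ a → (con 0ℚ :- a) :* (con 0ℚ :- a) := a :* a) refl a)))))

    nearestLabel : (Fin 2 → Point (suc s)) → Fin (s ℕ.+ w) → Fin 2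
    nearestLabel C x = proj₁ (argminF₂ (λ i → sqDist (X x) (C i)))

    cost≡assignedCost : ∀ C → cost X C ≡ Assignment.assignedCost (nearestLabel C) (λ i → Vec.head (C i)) (λ i → Vec.tail (C i))
    cost≡assignedCost C = sumF-cong (λ x → trans (proj₂ (argminF₂ (λ i → sqDist (X x) (C i))))
                                                  (cong (sqDist (X x)) (head∷tail (C (nearestLabel C x)))))

    s-1≤cost : 0ℚ < sq h → two < fromℕ w * sq h → ∀ C → fromℕ s - 1ℚ ≤ cost X C
    s-1≤cost 0<h² 2<wh² C = ≤-trans (Assignment.s-1≤assignedCost (nearestLabel C) (λ i → Vec.head (C i)) (λ i → Vec.tail (C i)) 0<h² 2<wh²)
                                    (≤-reflexive (sym (cost≡assignedCost C)))

    module Centres (0<s : 0ℚ < fromℕ s) where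

      σ : ℚ
      σ = recip (fromℕ s)

      s*σ≡1 : fromℕ s * σ ≡ 1ℚ
      s*σ≡1 = *-recip (fromℕ s) (pos⇒≢0 0<s)

      centre : Fin 2 → Point (suc s)
      centre zero = O
      centre (suc zero) = h ∷ replicate s σ

      labelOf : Fin s ⊎ Fin w → Fin 2
      labelOf (inj₁ _) = 1F
      labelOf (inj₂ _) = 0F

      splitLabel : Fin (s ℕ.+ w) → Fin 2
      splitLabel x = labelOf (Fin.splitAt s x)

      sqDist-q-centre₁ : ∀ l → sqDist (q l) (centre 1F) ≡ 1ℚ - σ
      sqDist-q-centre₁ l = trans (sqDist-q-replicate l h σ)
        (≡-moduloRecip (fromℕ s) σ s*σ≡1 (1ℚ - σ) (0ℚ - σ)
          (solve 3 (λ h n σ → (h :- h) :* (h :- h) :+ (n :* (σ :* σ) :+ (con 1ℚ :- (con 1ℚ :+ con 1ℚ) :* σ))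
                          := (con 1ℚ :- σ) :+ (con 1ℚ :- n :* σ) :* (con 0ℚ :- σ)) refl h (fromℕ s) σ))

      sqDist-q-centre₀ : ∀ l → sqDist (q l) (centre 0F) ≡ sq h + 1ℚ
      sqDist-q-centre₀ l = trans (sqDist-q-replicate l 0ℚ 0ℚ)
        (solve 2 (λ h n → (h :- con 0ℚ) :* (h :- con 0ℚ) :+ (n :* (con 0ℚ :* con 0ℚ) :+ (con 1ℚ :- (con 1ℚ :+ con 1ℚ) :* con 0ℚ))
                       := h :* h :+ con 1ℚ) refl h (fromℕ s))

      sqDist-O-centre₁ : sqDist O (centre 1F) ≡ sq h + σ
      sqDist-O-centre₁ = trans (sqDist-O-replicate h σ)
        (≡-moduloRecip (fromℕ s) σ s*σ≡1 (sq h + σ) (0ℚ - σ)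
          (solve 3 (λ h n σ → (con 0ℚ :- h) :* (con 0ℚ :- h) :+ n :* (σ :* σ) := (h :* h :+ σ) :+ (con 1ℚ :- n :* σ) :* (con 0ℚ :- σ))
             refl h (fromℕ s) σ))

      labelOf-closest : ∀ p l → sqDist (points p) (centre (labelOf p)) ≤ sqDist (points p) (centre l)
      labelOf-closest (inj₁ l) zero = begin
        sqDist (q l) (centre 1F)   ≡⟨ sqDist-q-centre₁ l ⟩
        1ℚ - σ                     ≤⟨ ≤-byGap (sq h + σ) (+-nonNeg (0≤sq h) (recip-nonNeg (fromℕ s) (<⇒≤ 0<s)))
                                        (solve 2 (λ h σ → h :* h :+ con 1ℚ := (con 1ℚ :- σ) :+ (h :* h :+ σ)) refl h σ) ⟩
        sq h + 1ℚ                  ≡⟨ sym (sqDist-q-centre₀ l) ⟩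
        sqDist (q l) (centre 0F)   ∎
        where open ≤-Reasoning
      labelOf-closest (inj₁ l) (suc zero) = ≤-refl
      labelOf-closest (inj₂ y) l = ≤-trans (≤-reflexive (sqDist-self O)) (sqDist-nonNeg O (centre l))

      splitLabel-closest : ClosestAssignment X centre splitLabel
      splitLabel-closest x = labelOf-closest (Fin.splitAt s x)

      cost-centre : cost X centre ≡ fromℕ s - 1ℚ
      cost-centre = begin
        cost X centre
          ≡⟨ sumF-cong (λ x → minF₂-at (λ i → sqDist (X x) (centre i)) (splitLabel x) (splitLabel-closest x)) ⟩
        sumF (λ x → sqDist (X x) (centre (splitLabel x)))
          ≡⟨ sumF-X (λ p → sqDist (points p) (centre (labelOf p))) ⟩
        sumF (λ l → sqDist (q l) (centre 1F)) + sumF {w} (λ _ → sqDist O O)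
          ≡⟨ cong₂ _+_ (trans (sumF-cong sqDist-q-centre₁) (sumF-const {s} (1ℚ - σ)))
                       (trans (sumF-cong {w} (λ _ → sqDist-self O)) (sumF-0 {w})) ⟩
        fromℕ s * (1ℚ - σ) + 0ℚ
          ≡⟨ ≡-moduloRecip (fromℕ s) σ s*σ≡1 (fromℕ s - 1ℚ) 1ℚ
               (solve 2 (λ n σ → n :* (con 1ℚ :- σ) :+ con 0ℚ := (n :- con 1ℚ) :+ (con 1ℚ :- n :* σ) :* con 1ℚ) refl (fromℕ s) σ) ⟩
        fromℕ s - 1ℚ ∎
        where open ≡-Reasoning

      deletionCost-centre : deletionCost X centre splitLabel 0F 1F ≡ (fromℕ s - 1ℚ) + fromℕ w * (sq h + σ)
      deletionCost-centre = begin
        deletionCost X centre splitLabel 0F 1F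
          ≡⟨ deletionCost₂ X centre splitLabel ⟩
        sumF (λ x → sqDist (X x) (centre 1F))
          ≡⟨ sumF-X (λ p → sqDist (points p) (centre 1F)) ⟩
        sumF (λ l → sqDist (q l) (centre 1F)) + sumF {w} (λ _ → sqDist O (centre 1F))
          ≡⟨ cong₂ _+_ (trans (sumF-cong sqDist-q-centre₁) (sumF-const {s} (1ℚ - σ)))
                       (trans (sumF-cong {w} (λ _ → sqDist-O-centre₁)) (sumF-const {w} (sq h + σ))) ⟩
        fromℕ s * (1ℚ - σ) + fromℕ w * (sq h + σ)
          ≡⟨ ≡-moduloRecip (fromℕ s) σ s*σ≡1 ((fromℕ s - 1ℚ) + fromℕ w * (sq h + σ)) 1ℚ
               (solve 4 (λ n σ m d → n :* (con 1ℚ :- σ) :+ m :* d := ((n :- con 1ℚ) :+ m :* d) :+ (con 1ℚ :- n :* σ) :* con 1ℚ)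
                  refl (fromℕ s) σ (fromℕ w) (sq h + σ)) ⟩
        (fromℕ s - 1ℚ) + fromℕ w * (sq h + σ) ∎
        where open ≡-Reasoning

  module Counterexample (c h G : ℚ) (s₁ w₁ : ℕ) (0<h² : 0ℚ < sq h) (2<wh² : two < fromℕ (suc w₁) * sq h)
    (1<s : 1ℚ < fromℕ (suc s₁)) (0<G : 0ℚ < G)
    (2G/w≤1 : two * (G * safeInv (suc w₁)) ≤ 1ℚ) (2G/s≤h² : two * (G * safeInv (suc s₁)) ≤ sq h)
    (wh²+w/s≤cG : fromℕ (suc w₁) * sq h + fromℕ (suc w₁) * recip (fromℕ (suc s₁)) ≤ c * G) where

    s w : ℕ
    s = suc s₁
    w = suc w₁

    0<w : 0ℚ < fromℕ w
    0<w = fromℕ-suc-pos w₁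

    open Instance h s w

    0<s : 0ℚ < fromℕ s
    0<s = <-trans (positive⁻¹ 1ℚ) 1<s

    open Centres 0<s

    0<s-1 : 0ℚ < fromℕ s - 1ℚ
    0<s-1 = ≤-<-trans (≤-reflexive (sym (+-inverseʳ 1ℚ))) (+-monoˡ-< (ℚ.- 1ℚ) 1<s)

    γ : ℚ
    γ = G * recip (fromℕ s - 1ℚ)

    0<γ : 0ℚ < γ
    0<γ = *-pos 0<G (recip-pos _ 0<s-1)

    γ*[s-1]≡G : γ * (fromℕ s - 1ℚ) ≡ G
    γ*[s-1]≡G = trans (*-assoc G _ _) (trans (cong (G *_) (trans (*-comm _ (fromℕ s - 1ℚ)) (*-recip _ (pos⇒≢0 0<s-1))))
                  (*-identityʳ G))

    centre-optimal : IsOptimalCenters X centre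
    centre-optimal C = ≤-trans (≤-reflexive cost-centre) (s-1≤cost 0<h² 2<wh² C)

    distinctPoints : HasKDistinctPoints {k = 2} X
    distinctPoints = pick , pick-injective
      where
      pick : Fin 2 → Fin (s ℕ.+ w)
      pick zero = s ↑ʳ zero
      pick (suc zero) = zero ↑ˡ w
      O≢q : ¬ (X (s ↑ʳ zero) ≡ X (zero ↑ˡ w))
      O≢q eq = <-irrefl (cong sq (∷-injectiveˡ (trans (sym (X-O zero)) (trans eq (X-q zero))))) 0<h²
      pick-injective : ∀ i j → X (pick i) ≡ X (pick j) → i ≡ j
      pick-injective zero zero _ = refl
      pick-injective zero (suc zero) eq = ⊥-elim (O≢q eq)
      pick-injective (suc zero) zero eq = ⊥-elim (O≢q (sym eq))
      pick-injective (suc zero) (suc zero) _ = refl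

    not-weaklyDeletionStable : ¬ WeaklyDeletionStable {k = 2} X (1ℚ + c * γ)
    not-weaklyDeletionStable stable =
      <⇒≱ (stable centre centre-optimal splitLabel splitLabel-closest 0F 1F (λ ())) (begin
        deletionCost X centre splitLabel 0F 1F    ≡⟨ deletionCost-centre ⟩
        (fromℕ s - 1ℚ) + fromℕ w * (sq h + σ)     ≡⟨ cong (fromℕ s - 1ℚ +_) (*-distribˡ-+ (fromℕ w) (sq h) σ) ⟩
        (fromℕ s - 1ℚ) + (fromℕ w * sq h + fromℕ w * σ)
                                                  ≤⟨ +-monoʳ-≤ (fromℕ s - 1ℚ) wh²+w/s≤cG ⟩
        (fromℕ s - 1ℚ) + c * G                    ≡⟨ cong (λ g → (fromℕ s - 1ℚ) + c * g) (sym γ*[s-1]≡G) ⟩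
        (fromℕ s - 1ℚ) + c * (γ * (fromℕ s - 1ℚ)) ≡⟨ solve 3 (λ m c g → m :+ c :* (g :* m) := (con 1ℚ :+ c :* g) :* m) refl (fromℕ s - 1ℚ) c γ ⟩
        (1ℚ + c * γ) * (fromℕ s - 1ℚ)             ≡⟨ cong ((1ℚ + c * γ) *_) (sym cost-centre) ⟩
        (1ℚ + c * γ) * cost X centre              ∎)
      where open ≤-Reasoning

    module _ (a : Fin (s ℕ.+ w) → Fin 2) (optimal : IsOptimalClustering X a) where

      private
        z : Fin 2 → ℚ
        z i = Vec.head (centroid X a i)

        v : Fin 2 → Vec ℚ s
        v i = Vec.tail (centroid X a i)

        open Assignment a z v

        clusterCost≡ : clusterCost X a ≡ assignedCost
        clusterCost≡ = sumF-cong (λ x → cong (sqDist (X x)) (head∷tail (centroid X a (a x))))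

        assignedCost≤s-1 : assignedCost ≤ fromℕ s - 1ℚ
        assignedCost≤s-1 = ≤-trans (≤-reflexive (sym clusterCost≡)) (≤-trans (proj₂ optimal centre) (≤-reflexive cost-centre))

        γ*OPT≤G : γ * clusterCost X a ≤ G
        γ*OPT≤G = ≤-trans (*-monoˡ-≤-nonNeg γ {{ℚ.nonNegative (<⇒≤ 0<γ)}} (≤-trans (≤-reflexive clusterCost≡) assignedCost≤s-1))
                          (≤-reflexive γ*[s-1]≡G)

        2γOPT/m≤2G/m : ∀ m → two * (γ * clusterCost X a * safeInv m) ≤ two * (G * safeInv m)
        2γOPT/m≤2G/m m = *-monoˡ-≤-nonNeg two {{_}} (*-monoʳ-≤-nonNeg (safeInv m) {{ℚ.nonNegative (safeInv-nonNeg m)}} γ*OPT≤G)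

        Far : Fin 2 → Fin (s ℕ.+ w) → Set
        Far k x = γ * clusterCost X a * safeInv (size X a k) ≤ sqDist (X x) (centroid X a k)

        module _ (i : Fin 2) (split : IsSplit i) where

          j = other i

          fromℕ-size-split : ∀ k → fromℕ (size X a k) ≡ fromℕ s * δ j k + fromℕ w * δ i k
          fromℕ-size-split k = begin
            fromℕ (size X a k)    ≡⟨ fromℕ-size X a k ⟩
            count a k             ≡⟨ sumF-++ s (λ x → δ (a x) k) ⟩
            nq k + nO k           ≡⟨ cong₂ _+_ (count-const labelQ j (proj₁ split) k) (count-const labelO i (proj₂ split) k) ⟩
            fromℕ s * δ j k + fromℕ w * δ i k ∎
            where open ≡-Reasoning

          size-i : size X a i ≡ w
          size-i = fromℕ-injective _ w (trans (fromℕ-size-split i)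
            (trans (cong₂ (λ p r → fromℕ s * p + fromℕ w * r) (δ-≢ (other-≢ i)) (δ-diag i))
              (solve 2 (λ n m → n :* con 0ℚ :+ m :* con 1ℚ := m) refl (fromℕ s) (fromℕ w))))

          size-j : size X a j ≡ s
          size-j = fromℕ-injective _ s (trans (fromℕ-size-split j)
            (trans (cong₂ (λ p r → fromℕ s * p + fromℕ w * r) (δ-diag j) (δ-≢ (λ i≡j → other-≢ i (sym i≡j))))
              (solve 2 (λ n m → n :* con 1ℚ :+ m :* con 0ℚ := n) refl (fromℕ s) (fromℕ w))))

          pinned = split-centres-pinned 0<s 0<w i split assignedCost≤s-1

          q-far : ∀ l → Far i (l ↑ˡ w)
          q-far l = *-cancelˡ-≤-pos two (begin
            two * (γ * clusterCost X a * safeInv (size X a i))  ≡⟨ cong (λ m → two * (γ * clusterCost X a * safeInv m)) size-i ⟩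
            two * (γ * clusterCost X a * safeInv w)             ≤⟨ 2γOPT/m≤2G/m w ⟩
            two * (G * safeInv w)                               ≤⟨ 2G/w≤1 ⟩
            1ℚ                                                  ≤⟨ sqDist-q≥ l (z i) (v i) ⟩
            two * sqDist (q l) (z i ∷ v i) + two * sq (0ℚ - vc i l)
              ≤⟨ +-monoʳ-≤ (two * sqDist (q l) (z i ∷ v i)) (*-monoˡ-≤-nonNeg two {{_}} (proj₂ pinned l)) ⟩
            two * sqDist (q l) (z i ∷ v i) + two * 0ℚ           ≡⟨ +-identityʳ _ ⟩
            two * sqDist (q l) (z i ∷ v i)                      ≡⟨ cong (two *_) (sym (cong₂ sqDist (X-q l) (head∷tail (centroid X a i)))) ⟩
            two * sqDist (X (l ↑ˡ w)) (centroid X a i)          ∎)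
            where open ≤-Reasoning

          O-far : ∀ y → Far j (s ↑ʳ y)
          O-far y = *-cancelˡ-≤-pos two (begin
            two * (γ * clusterCost X a * safeInv (size X a j))  ≡⟨ cong (λ m → two * (γ * clusterCost X a * safeInv m)) size-j ⟩
            two * (γ * clusterCost X a * safeInv s)             ≤⟨ 2γOPT/m≤2G/m s ⟩
            two * (G * safeInv s)                               ≤⟨ 2G/s≤h² ⟩
            sq h                                                ≤⟨ sqDist-O≥ (z j) (v j) ⟩
            two * sqDist O (z j ∷ v j) + two * sq (h - z j)
              ≤⟨ +-monoʳ-≤ (two * sqDist O (z j ∷ v j)) (*-monoˡ-≤-nonNeg two {{_}} (proj₁ pinned)) ⟩
            two * sqDist O (z j ∷ v j) + two * 0ℚ               ≡⟨ +-identityʳ _ ⟩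
            two * sqDist O (z j ∷ v j)                          ≡⟨ cong (two *_) (sym (cong₂ sqDist (X-O y) (head∷tail (centroid X a j)))) ⟩
            two * sqDist (X (s ↑ʳ y)) (centroid X a j)          ∎)
            where open ≤-Reasoning

          far : ∀ k x → ¬ (a x ≡ k) → Far k x
          far k x ax≢k = byPosition (↑ˡ-or-↑ʳ s x)
            where
            byPosition : (Σ (Fin s) λ l → l ↑ˡ w ≡ x) ⊎ (Σ (Fin w) λ y → s ↑ʳ y ≡ x) → Far k x
            byPosition (inj₁ (l , refl)) = subst (λ k → Far k (l ↑ˡ w)) (sym k≡i) (q-far l)
              where
              k≡i : k ≡ i
              k≡i = trans (≢⇒other (λ k≡j → ax≢k (trans (proj₁ split l) (sym k≡j)))) (other-involutive i)
            byPosition (inj₂ (y , refl)) = subst (λ k → Far k (s ↑ʳ y)) (sym k≡j) (O-far y)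
              where
              k≡j : k ≡ j
              k≡j = ≢⇒other (λ k≡i → ax≢k (trans (proj₂ split y) (sym k≡i)))

      farFromOtherCentroids : ∀ k x → ¬ (a x ≡ k) → Far k x
      farFromOtherCentroids = bySplit (assignedCost≤s-1⇒split 0<h² 2<wh² assignedCost≤s-1)
        where
        bySplit : IsSplit 0F ⊎ IsSplit 1F → ∀ k x → ¬ (a x ≡ k) → Far k x
        bySplit (inj₁ split) = far 0F split
        bySplit (inj₂ split) = far 1F split

    γ-distributed : GammaDistributed {k = 2} X γ
    γ-distributed = farFromOtherCentroids

  -- n = 2(1 + m) ≥ 2/c.
  module Parameters (c : ℚ) (m : ℕ) (1≤c[1+m] : 1ℚ ≤ c * fromℕ (suc m)) where

    N : ℕ
    N = suc (suc (m ℕ.+ m))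

    n three : ℚ
    n = fromℕ N
    three = fromℕ 3

    h G : ℚ
    h = recip n
    G = n * n

    w₁ s₁ : ℕ
    w₁ = ℕ.pred (3 ℕ.* N ℕ.* N)
    s₁ = ℕ.pred (3 ℕ.* N ℕ.* N ℕ.* N ℕ.* N)

    0<n : 0ℚ < n
    0<n = fromℕ-suc-pos (suc (m ℕ.+ m))

    n*h≡1 : n * h ≡ 1ℚ
    n*h≡1 = *-recip n (pos⇒≢0 0<n)

    w≡3n² : fromℕ (suc w₁) ≡ three * n * n
    w≡3n² = trans (fromℕ-* (3 ℕ.* N) N) (cong (_* n) (fromℕ-* 3 N))

    s≡3n⁴ : fromℕ (suc s₁) ≡ three * n * n * n * n
    s≡3n⁴ = trans (fromℕ-* (3 ℕ.* N ℕ.* N ℕ.* N) N) (cong (_* n) (trans (fromℕ-* (3 ℕ.* N ℕ.* N) N) (cong (_* n) w≡3n²)))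

    0<h² : 0ℚ < sq h
    0<h² = *-pos (recip-pos n 0<n) (recip-pos n 0<n)

    1<s : 1ℚ < fromℕ (suc s₁)
    1<s = 1<fromℕ-2+ (ℕ.pred s₁)

    0<G : 0ℚ < G
    0<G = *-pos 0<n 0<n

    2<wh² : two < fromℕ (suc w₁) * sq h
    2<wh² = begin-strict
      two                       <⟨ +-monoʳ-< two (positive⁻¹ 1ℚ) ⟩
      two + 1ℚ                  ≡⟨ ≡-moduloRecip n h n*h≡1 (three * n * n * sq h) (three * (1ℚ + n * h))
                                     (solve 2 (λ n h → (con 1ℚ :+ con 1ℚ) :+ con 1ℚ
                                        := con (fromℕ 3) :* n :* n :* (h :* h) :+ (con 1ℚ :- n :* h) :* (con (fromℕ 3) :* (con 1ℚ :+ n :* h)))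
                                        refl n h) ⟩
      three * n * n * sq h      ≡⟨ cong (_* sq h) (sym w≡3n²) ⟩
      fromℕ (suc w₁) * sq h     ∎
      where open ≤-Reasoning

    2G/w≤1 : two * (G * safeInv (suc w₁)) ≤ 1ℚ
    2G/w≤1 = ≤-byGap (G * y) (*-nonNeg (<⇒≤ 0<G) (safeInv-nonNeg (suc w₁)))
      (≡-moduloRecip (three * n * n) y (trans (*-comm _ y) (subst (λ W → y * W ≡ 1ℚ) w≡3n² (safeInv*fromℕ w₁))) _ 1ℚ
        (solve 2 (λ n y → con 1ℚ := ((con 1ℚ :+ con 1ℚ) :* (n :* n :* y) :+ n :* n :* y)
                                    :+ (con 1ℚ :- con (fromℕ 3) :* n :* n :* y) :* con 1ℚ) refl n y))
      where y = safeInv (suc w₁)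

    2G/s≤h² : two * (G * safeInv (suc s₁)) ≤ sq h
    2G/s≤h² = ≤-byGap (G * y) (*-nonNeg (<⇒≤ 0<G) (safeInv-nonNeg (suc s₁)))
      (≡-moduloRecip n h n*h≡1 _ (0ℚ - three * n * n * y * (1ℚ + n * h))
        (≡-moduloRecip (three * n * n * n * n) y (trans (*-comm _ y) (subst (λ S → y * S ≡ 1ℚ) s≡3n⁴ (safeInv*fromℕ s₁))) _ (h * h)
          (solve 3 (λ n h y → h :* h
             := (((con 1ℚ :+ con 1ℚ) :* (n :* n :* y) :+ n :* n :* y) :+ (con 1ℚ :- n :* h) :* (con 0ℚ :- con (fromℕ 3) :* n :* n :* y :* (con 1ℚ :+ n :* h)))
                :+ (con 1ℚ :- con (fromℕ 3) :* n :* n :* n :* n :* y) :* (h :* h)) refl n h y)))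
      where y = safeInv (suc s₁)

    h≤1 : h ≤ 1ℚ
    h≤1 = begin
      h          ≡⟨ sym (*-identityʳ h) ⟩
      h * 1ℚ     ≤⟨ *-monoˡ-≤-nonNeg h {{ℚ.nonNegative (recip-nonNeg n (<⇒≤ 0<n))}} (1≤fromℕ-suc (suc (m ℕ.+ m))) ⟩
      h * n      ≡⟨ trans (*-comm h n) n*h≡1 ⟩
      1ℚ         ∎
      where open ≤-Reasoning

    4≤cG : three + 1ℚ ≤ c * G
    4≤cG = begin
      three + 1ℚ                   ≡⟨ solve 0 (con (fromℕ 3) :+ con 1ℚ := (con 1ℚ :+ con 1ℚ) :* (con 1ℚ :+ con 1ℚ) :* con 1ℚ) refl ⟩
      two * two * 1ℚ               ≤⟨ *-monoˡ-≤-nonNeg (two * two) {{_}} (≤-trans (1≤fromℕ-suc m) (≤-reflexive (sym (*-identityʳ _)))) ⟩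
      two * two * (k * 1ℚ)         ≤⟨ *-monoˡ-≤-nonNeg (two * two) {{_}} (*-monoˡ-≤-nonNeg k {{ℚ.nonNegative (fromℕ-nonNeg (suc m))}} 1≤c[1+m]) ⟩
      two * two * (k * (c * k))    ≡⟨ solve 2 (λ c k → (con 1ℚ :+ con 1ℚ) :* (con 1ℚ :+ con 1ℚ) :* (k :* (c :* k))
                                         := c :* (((con 1ℚ :+ con 1ℚ) :* k) :* ((con 1ℚ :+ con 1ℚ) :* k))) refl c k ⟩
      c * ((two * k) * (two * k))  ≡⟨ cong (λ p → c * (p * p)) (sym n≡2k) ⟩
      c * G                        ∎
      where
      open ≤-Reasoning
      k = fromℕ (suc m)
      n≡2k : n ≡ two * k
      n≡2k = trans (cong (λ t → 1ℚ + (1ℚ + t)) (fromℕ-+ m m))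
        (solve 1 (λ t → con 1ℚ :+ (con 1ℚ :+ (t :+ t)) := (con 1ℚ :+ con 1ℚ) :* (con 1ℚ :+ t)) refl (fromℕ m))

    wh²+w/s≤cG : fromℕ (suc w₁) * sq h + fromℕ (suc w₁) * recip (fromℕ (suc s₁)) ≤ c * G
    wh²+w/s≤cG = begin
      fromℕ (suc w₁) * sq h + fromℕ (suc w₁) * r
        ≡⟨ cong (λ W → W * sq h + W * r) w≡3n² ⟩
      three * n * n * sq h + three * n * n * r
        ≡⟨ ≡-moduloRecip n h n*h≡1 _ ((three * n * n * r - three) * (1ℚ + n * h))
             (≡-moduloRecip (three * n * n * n * n) r (subst (λ S → S * r ≡ 1ℚ) s≡3n⁴ (*-recip (fromℕ (suc s₁)) (pos⇒≢0 (<-trans (positive⁻¹ 1ℚ) 1<s))))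
                _ (0ℚ - h * h)
               (solve 3 (λ n h r → con (fromℕ 3) :* n :* n :* (h :* h) :+ con (fromℕ 3) :* n :* n :* r
                  := ((con (fromℕ 3) :+ h :* h) :+ (con 1ℚ :- n :* h) :* ((con (fromℕ 3) :* n :* n :* r :- con (fromℕ 3)) :* (con 1ℚ :+ n :* h)))
                     :+ (con 1ℚ :- con (fromℕ 3) :* n :* n :* n :* n :* r) :* (con 0ℚ :- h :* h)) refl n h r)) ⟩
      three + sq h
        ≤⟨ +-monoʳ-≤ three (≤-trans (*-monoˡ-≤-nonNeg h {{ℚ.nonNegative (recip-nonNeg n (<⇒≤ 0<n))}} h≤1)
                                    (≤-trans (≤-reflexive (*-identityʳ h)) h≤1)) ⟩
      three + 1ℚ
        ≤⟨ 4≤cG ⟩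
      c * G ∎
      where
      open ≤-Reasoning
      r = recip (fromℕ (suc s₁))

open import Defs
open import Data.Nat using (ℕ; _≤_)
open import Data.Fin using (Fin)
open import Data.Rational using (ℚ; 0ℚ; 1ℚ; _+_; _*_; _<_)
open import Data.Product using (Σ-syntax; _×_)
open import Relation.Nullary using (¬_)
open import Data.Nat using (s≤s; z≤n)
open import Data.Product using (_,_)
open KMeansCounterexample

theorem11 : ∀ (c : ℚ) → 0ℚ < c →
    Σ[ γ ∈ ℚ ] (0ℚ < γ ×
    Σ[ d ∈ ℕ ] Σ[ n ∈ ℕ ] Σ[ k ∈ ℕ ] Σ[ X ∈ (Fin n → Point d) ]
    (1 ≤ k × HasKDistinctPoints {k = k} X ×
    GammaDistributed {k = k} X γ ×
    ¬ WeaklyDeletionStable {k = k} X (1ℚ + c * γ)))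
theorem11 c 0<c with archimedean c 0<c
... | m , 1≤c[1+m] =
  γ , 0<γ , _ , _ , 2 , Instance.X h _ _ , s≤s z≤n , distinctPoints , γ-distributed , not-weaklyDeletionStable
  where
  open Parameters c m 1≤c[1+m]
  open Counterexample c h G s₁ w₁ 0<h² 2<wh² 1<s 0<G 2G/w≤1 2G/s≤h² wh²+w/s≤cG
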